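{- Let $G$ be a unicyclic graph of order $n$ with girth $g(G)=4$. Then $PC(G)=n-2$ if and only if $G\in\mathcal{D}_1\cup\mathcal{D}_2$.
   Context: A unicyclic graph is a connected graph with exactly one cycle; its girth is the length of that cycle. $\mathcal{D}_1$ is the family of graphs obtained from a $4$-cycle by attaching one or more pendant leaves to a single vertex of the cycle. $\mathcal{D}_2$ is the family of graphs obtained from a $4$-cycle $(a,b,c,d)$ by attaching one or more pendant leaves to $a$ and one or more pendant leaves to the opposite vertex $c$. A paired dominating set of $G$ is a dominating set $S$ such that $G[S]$ has a perfect matching. Two disjoint sets form a paired coalition if neither is a paired dominating set but their union is. A $pc$-partition of $G$ is a partition of $V(G)$ into nonempty sets, none a paired dominating set, each forming a paired coalition with some other set of the partition. $PC(G)$ is the maximum number of sets in a $pc$-partition ($0$ if none exists). -}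

module Defs where

open import Data.Nat using (ℕ; zero; suc; _≤_; _<_; _∸_)
open import Data.Nat.Properties using (_<?_)
open import Data.Fin using (Fin; zero; suc; toℕ; fromℕ<)
open import Data.Bool using (Bool; true; false)
open import Data.Product using (Σ; ∃; _×_; _,_)
open import Data.Sum using (_⊎_)
open import Relation.Nullary using (¬_; yes; no)
open import Relation.Binary.PropositionalEquality using (_≡_; _≢_)
open import Function.Definitions using (Injective)
open import Function.Bundles using (_⇔_)

record Graph (n : ℕ) : Set where
  field
    adj   : Fin n → Fin n → Bool
    sym   : ∀ u v → adj u v ≡ adj v u
    irref : ∀ v → adj v v ≡ false

module _ {n : ℕ} (G : Graph n) where
  open Graph G

  Adj : Fin n → Fin n → Set
  Adj u v = adj u v ≡ true

  data Reach : Fin n → Fin n → Set where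
    here : ∀ {v} → Reach v v
    step : ∀ {u w v} → Adj u w → Reach w v → Reach u v

  Connected : Set
  Connected = ∀ u v → Reach u v

  nextF : ∀ {m} → Fin (suc m) → Fin (suc m)
  nextF {m} i with suc (toℕ i) <? suc m
  ... | yes p = fromℕ< p
  ... | no _  = zero

  record Cycle : Set where
    field
      pred-len : ℕ
      len≥3    : 3 ≤ suc pred-len
      vert     : Fin (suc pred-len) → Fin n
      distinct : Injective _≡_ _≡_ vert
      around   : ∀ i → Adj (vert i) (vert (nextF i))

  cycLength : Cycle → ℕ
  cycLength C = suc (Cycle.pred-len C)

  CycEdge : Cycle → Fin n → Fin n → Set
  CycEdge C u v = ∃ λ i → (vert i ≡ u × vert (nextF i) ≡ v) ⊎ (vert i ≡ v × vert (nextF i) ≡ u)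
    where open Cycle C

  -- connected graph with exactly one cycle (cycles identified as subgraphs, i.e. by edge set)
  Unicyclic : Set
  Unicyclic = Connected × (Σ Cycle λ C → ∀ (C' : Cycle) → ∀ u v → CycEdge C u v ⇔ CycEdge C' u v)

  Girth : ℕ → Set
  Girth g = (Σ Cycle λ C → cycLength C ≡ g) × (∀ (C : Cycle) → g ≤ cycLength C)

  InD1 : Set
  InD1 = Σ (Fin n) λ a → Σ (Fin n) λ b → Σ (Fin n) λ c → Σ (Fin n) λ d →
    (a ≢ b × a ≢ c × a ≢ d × b ≢ c × b ≢ d × c ≢ d) ×
    (Adj a b × Adj b c × Adj c d × Adj d a × ¬ Adj a c × ¬ Adj b d) ×
    (∀ v → v ≢ a → v ≢ b → v ≢ c → v ≢ d → ∀ w → Adj v w ⇔ (w ≡ a)) ×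
    (Σ (Fin n) λ v → v ≢ a × v ≢ b × v ≢ c × v ≢ d)

  InD2 : Set
  InD2 = Σ (Fin n) λ a → Σ (Fin n) λ b → Σ (Fin n) λ c → Σ (Fin n) λ d →
    (a ≢ b × a ≢ c × a ≢ d × b ≢ c × b ≢ d × c ≢ d) ×
    (Adj a b × Adj b c × Adj c d × Adj d a × ¬ Adj a c × ¬ Adj b d) ×
    (∀ v → v ≢ a → v ≢ b → v ≢ c → v ≢ d →
       (∀ w → Adj v w ⇔ (w ≡ a)) ⊎ (∀ w → Adj v w ⇔ (w ≡ c))) ×
    (Σ (Fin n) λ v → v ≢ a × v ≢ b × v ≢ c × v ≢ d × (∀ w → Adj v w ⇔ (w ≡ a))) ×
    (Σ (Fin n) λ v → v ≢ a × v ≢ b × v ≢ c × v ≢ d × (∀ w → Adj v w ⇔ (w ≡ c)))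

  Dominating : (Fin n → Set) → Set
  Dominating S = ∀ v → S v ⊎ (Σ (Fin n) λ u → S u × Adj v u)

  -- G[S] has a perfect matching: a fixed-point-free involution on S along edges
  HasPerfectMatching : (Fin n → Set) → Set
  HasPerfectMatching S = Σ (Fin n → Fin n) λ m →
    ∀ v → S v → S (m v) × m v ≢ v × m (m v) ≡ v × Adj v (m v)

  PairedDominating : (Fin n → Set) → Set
  PairedDominating S = Dominating S × HasPerfectMatching S

  PcPartition : ℕ → Set
  PcPartition k = Σ (Fin n → Fin k) λ f →
    (∀ i → Σ (Fin n) λ v → f v ≡ i) ×
    (∀ i → ¬ PairedDominating (λ v → f v ≡ i)) ×
    (∀ i → Σ (Fin k) λ j → j ≢ i × PairedDominating (λ v → f v ≡ i ⊎ f v ≡ j))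

  -- PC(G) = p : p is the maximum order of a pc-partition, or 0 if none exists
  PCis : ℕ → Set
  PCis p = (PcPartition p × (∀ k → PcPartition k → k ≤ p))
         ⊎ (p ≡ 0 × (∀ k → ¬ PcPartition k))

{-# OPTIONS --safe #-}
-- Girth 4 makes G triangle-free, and as G is unicyclic every cycle runs on its
-- 4-cycle abcd, the square.  With one representative per class, a pc-partition of
-- order n − 2 leaves exactly two further vertices.  Hence some class is a singleton,
-- and its coalition partner is either a singleton (a dominating edge whose ends are
-- not both supports, since with three or more classes all supports share a class) or
-- a three-element class T, all other classes being singletons whose union with T is
-- paired dominating.  Then T is a path t₁t₂t₃ with every other vertex adjacent to t₁
-- or t₃, or an edge t₂t₃ and a vertex t₁ adjacent to everything else.  Set against
-- the square, each configuration forces every vertex off the square to be a leaf at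
-- one corner or at two opposite corners, i.e. G ∈ D₁ ∪ D₂.  Conversely, in D₁ ∪ D₂
-- the paired dominating union of the class of a leaf l at a with its partner holds
-- l, its mate a, a vertex dominating c and that vertex's mate: four vertices in two
-- classes, so PC ≤ n − 2, attained by {a, b, c} and singletons.  For n = 4, G = C₄
-- has the pc-partition into four singletons.
module Submission where

open import Defs
open import Data.Nat using (ℕ; zero; suc; _+_; _∸_; _≤_; z≤n; s≤s)
import Data.Nat.Properties as ℕ
open import Data.Fin using (Fin; zero; suc; toℕ; splitAt; join; punchIn; punchOut) renaming (_≟_ to _≟ᶠ_)
import Data.Fin.Properties as Fin
open import Data.Fin.Permutation.Components using (transpose)
open import Data.Vec using (Vec; []; _∷_; lookup)
open import Data.Vec.Relation.Unary.All using (All; []; _∷_)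
open import Data.Vec.Relation.Unary.AllPairs using ([]; _∷_)
import Data.Vec.Relation.Unary.All.Properties as All
open import Data.Vec.Relation.Unary.Unique.Propositional using (Unique)
open import Data.Vec.Relation.Unary.Unique.Propositional.Properties using (lookup-injective)
open import Data.Bool using (true)
import Data.Bool.Properties as Bool
open import Data.Product using (Σ; _×_; _,_; proj₁; proj₂; map₂)
open import Data.Sum using (_⊎_; inj₁; inj₂; [_,_]′)
import Data.Sum as Sum
open import Data.Empty using (⊥; ⊥-elim)
open import Relation.Nullary using (¬_; Dec; yes; no)
open import Relation.Nullary.Decidable using (_×-dec_; _⊎-dec_; ¬?; dec-true; dec-false; decidable-stable)
open import Relation.Unary using (_⊆_; _∪_)
open import Relation.Binary.PropositionalEquality
open import Function using (_∘_)
open import Function.Bundles using (_⇔_; mk⇔; Equivalence)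

transpose-ˡ : ∀ {m} (i j : Fin m) → transpose i j i ≡ j
transpose-ˡ i j rewrite dec-true (i ≟ᶠ i) refl = refl

transpose-ʳ : ∀ {m} (i j : Fin m) → transpose i j j ≡ i
transpose-ʳ i j with j ≟ᶠ i
... | yes refl = refl
... | no _   rewrite dec-true (j ≟ᶠ j) refl = refl

transpose-other : ∀ {m} {i j k : Fin m} → k ≢ i → k ≢ j → transpose i j k ≡ k
transpose-other {i = i} {j} {k} k≢i k≢j rewrite dec-false (k ≟ᶠ i) k≢i | dec-false (k ≟ᶠ j) k≢j = refl

unique⇒≤ : ∀ {m n} {vs : Vec (Fin n) m} → Unique vs → m ≤ n
unique⇒≤ unique = Fin.injective⇒≤ λ {i} {j} → lookup-injective unique i j

module _ {A : Set} where

  Pair : A → A → A → Set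
  Pair x y w = w ≡ x ⊎ w ≡ y

  Triple : A → A → A → A → Set
  Triple x y z w = w ≡ x ⊎ w ≡ y ⊎ w ≡ z

  Quad : A → A → A → A → A → Set
  Quad x y z t w = w ≡ x ⊎ w ≡ y ⊎ w ≡ z ⊎ w ≡ t

  ∉-triple : ∀ {x y z w} → w ≢ x → w ≢ y → w ≢ z → ¬ Triple x y z w
  ∉-triple w≢x w≢y w≢z = [ w≢x , [ w≢y , w≢z ]′ ]′

  two-of-three : ∀ {i j a b c : A} → Pair i j a → Pair i j b → Pair i j c →
                 a ≡ b ⊎ a ≡ c ⊎ b ≡ c
  two-of-three (inj₁ refl) (inj₁ refl) _           = inj₁ refl
  two-of-three (inj₂ refl) (inj₂ refl) _           = inj₁ refl
  two-of-three (inj₁ refl) (inj₂ refl) (inj₁ refl) = inj₂ (inj₁ refl)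
  two-of-three (inj₁ refl) (inj₂ refl) (inj₂ refl) = inj₂ (inj₂ refl)
  two-of-three (inj₂ refl) (inj₁ refl) (inj₁ refl) = inj₂ (inj₂ refl)
  two-of-three (inj₂ refl) (inj₁ refl) (inj₂ refl) = inj₂ (inj₁ refl)

three-distinct : ∀ {k} → 3 ≤ k →
                 Σ (Fin k) λ i₀ → Σ (Fin k) λ i₁ → Σ (Fin k) λ i₂ → i₀ ≢ i₁ × i₀ ≢ i₂ × i₁ ≢ i₂
three-distinct (s≤s (s≤s (s≤s _))) = zero , suc zero , suc (suc zero) , (λ ()) , (λ ()) , (λ ())

avoid-two : ∀ {k} → 3 ≤ k → (p q : Fin k) → Σ (Fin k) λ i → i ≢ p × i ≢ q
avoid-two {k} 3≤k p q with three-distinct 3≤k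
... | i₀ , i₁ , i₂ , i₀≢i₁ , i₀≢i₂ , i₁≢i₂ with outside i₀ | outside i₁ | outside i₂
  where
  outside : (i : Fin k) → Dec (Pair p q i)
  outside i = (i ≟ᶠ p) ⊎-dec (i ≟ᶠ q)
...   | no out  | _       | _       = i₀ , out ∘ inj₁ , out ∘ inj₂
...   | yes _   | no out  | _       = i₁ , out ∘ inj₁ , out ∘ inj₂
...   | yes _   | yes _   | no out  = i₂ , out ∘ inj₁ , out ∘ inj₂
...   | yes in₀ | yes in₁ | yes in₂ with two-of-three in₀ in₁ in₂
...     | inj₁ e        = ⊥-elim (i₀≢i₁ e)
...     | inj₂ (inj₁ e) = ⊥-elim (i₀≢i₂ e)
...     | inj₂ (inj₂ e) = ⊥-elim (i₁≢i₂ e)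

module Basics {n : ℕ} (G : Graph n) where

  infix 4 _~_

  _~_ : Fin n → Fin n → Set
  _~_ = Adj G

  _~?_ : ∀ x y → Dec (x ~ y)
  x ~? y = Graph.adj G x y Bool.≟ true

  ~-sym : ∀ {x y} → x ~ y → y ~ x
  ~-sym {x} {y} = trans (Graph.sym G y x)

  ~-irrefl : ∀ {x} → ¬ x ~ x
  ~-irrefl {x} x~x with trans (sym (Graph.irref G x)) x~x
  ... | ()

  ~⇒≢ : ∀ {x y} → x ~ y → x ≢ y
  ~⇒≢ x~x refl = ~-irrefl x~x

  TriangleFree : Set
  TriangleFree = ∀ {x y z} → x ~ y → y ~ z → z ~ x → ⊥

  -- The leaf l is not required to be adjacent to x: the domination arguments only
  -- use that it has no other neighbour.
  OnlyNeighbour : Fin n → Fin n → Set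
  OnlyNeighbour l x = ∀ z → l ~ z → z ≡ x

  IsSupport : Fin n → Set
  IsSupport x = Σ (Fin n) λ l → OnlyNeighbour l x

  LeafAt : Fin n → Fin n → Set
  LeafAt l x = ∀ w → l ~ w ⇔ w ≡ x

  leafAt : ∀ {l x} → l ~ x → OnlyNeighbour l x → LeafAt l x
  leafAt l~x only w = mk⇔ (only w) λ { refl → l~x }

  leaf⇒support : ∀ {l x} → LeafAt l x → IsSupport x
  leaf⇒support {l} leaf = l , λ w → Equivalence.to (leaf w)

  Dominates : Fin n → Fin n → Set
  Dominates p q = ∀ w → w ≡ p ⊎ w ≡ q ⊎ w ~ p ⊎ w ~ q

  dominates-sym : ∀ {p q} → Dominates p q → Dominates q p
  dominates-sym dominates w with dominates w
  ... | inj₁ w≡p               = inj₂ (inj₁ w≡p)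
  ... | inj₂ (inj₁ w≡q)        = inj₁ w≡q
  ... | inj₂ (inj₂ (inj₁ w~p)) = inj₂ (inj₂ (inj₂ w~p))
  ... | inj₂ (inj₂ (inj₂ w~q)) = inj₂ (inj₂ (inj₁ w~q))

  CoveredByTwoEdges : Fin n → Fin n → Fin n → Fin n → Set
  CoveredByTwoEdges p q r t = (p ~ q × r ~ t) ⊎ (p ~ r × q ~ t) ⊎ (p ~ t × q ~ r)

  cycle : ∀ {m} (vs : Vec (Fin n) (3 + m)) → Unique vs →
          (∀ i → lookup vs i ~ lookup vs (nextF G i)) → Cycle G
  cycle {m} vs unique around = record
    { pred-len = 2 + m ; len≥3 = s≤s (s≤s (s≤s z≤n)) ; vert = lookup vs
    ; distinct = λ {i} {j} → lookup-injective unique i j ; around = around }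

  triangle : ∀ {x y z} → x ~ y → y ~ z → z ~ x → Cycle G
  triangle {x} {y} {z} x~y y~z z~x = cycle (x ∷ y ∷ z ∷ []) unique around
    where
    unique : Unique (x ∷ y ∷ z ∷ [])
    unique = (~⇒≢ x~y ∷ ~⇒≢ (~-sym z~x) ∷ []) ∷ (~⇒≢ y~z ∷ []) ∷ [] ∷ []
    around : ∀ i → lookup (x ∷ y ∷ z ∷ []) i ~ lookup (x ∷ y ∷ z ∷ []) (nextF G i)
    around zero             = x~y
    around (suc zero)       = y~z
    around (suc (suc zero)) = z~x

  quadrangle : ∀ {x y z t} → Unique (x ∷ y ∷ z ∷ t ∷ []) →
               x ~ y → y ~ z → z ~ t → t ~ x → Cycle G
  quadrangle {x} {y} {z} {t} unique x~y y~z z~t t~x = cycle (x ∷ y ∷ z ∷ t ∷ []) unique around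
    where
    around : ∀ i → lookup (x ∷ y ∷ z ∷ t ∷ []) i ~ lookup (x ∷ y ∷ z ∷ t ∷ []) (nextF G i)
    around zero                   = x~y
    around (suc zero)             = y~z
    around (suc (suc zero))       = z~t
    around (suc (suc (suc zero))) = t~x

  pentagon : ∀ {x y z t u} → Unique (x ∷ y ∷ z ∷ t ∷ u ∷ []) →
             x ~ y → y ~ z → z ~ t → t ~ u → u ~ x → Cycle G
  pentagon {x} {y} {z} {t} {u} unique x~y y~z z~t t~u u~x = cycle (x ∷ y ∷ z ∷ t ∷ u ∷ []) unique around
    where
    around : ∀ i → lookup (x ∷ y ∷ z ∷ t ∷ u ∷ []) i ~ lookup (x ∷ y ∷ z ∷ t ∷ u ∷ []) (nextF G i)
    around zero                         = x~y
    around (suc zero)                   = y~z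
    around (suc (suc zero))             = z~t
    around (suc (suc (suc zero)))       = t~u
    around (suc (suc (suc (suc zero)))) = u~x

  girth4⇒triangle-free : Girth G 4 → TriangleFree
  girth4⇒triangle-free (_ , shortest) x~y y~z z~x with shortest (triangle x~y y~z z~x)
  ... | s≤s (s≤s (s≤s ()))

module PairedDomination {n : ℕ} (G : Graph n) where
  open Basics G

  PD : (Fin n → Set) → Set
  PD = PairedDominating G

  HasPM : (Fin n → Set) → Set
  HasPM = HasPerfectMatching G

  pd-resp : ∀ {S S′ : Fin n → Set} → S ⊆ S′ → S′ ⊆ S → PD S → PD S′
  pd-resp {S} {S′} S⊆S′ S′⊆S (dom , mate , match) = dom' , mate , match'
    where
    dom' : Dominating G S′
    dom' w with dom w
    ... | inj₁ sw            = inj₁ (S⊆S′ sw)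
    ... | inj₂ (u , su , w~u) = inj₂ (u , S⊆S′ su , w~u)
    match' : ∀ v → S′ v → S′ (mate v) × mate v ≢ v × mate (mate v) ≡ v × v ~ mate v
    match' v s'v with match v (S′⊆S s'v)
    ... | smv , rest = S⊆S′ smv , rest

  support∈pd : ∀ {S x} → IsSupport x → PD S → S x
  support∈pd {S} (l , only) (dom , mate , match) with dom l
  ... | inj₁ sl with match l sl
  ...   | sml , _ , _ , l~ml = subst S (only (mate l) l~ml) sml
  support∈pd {S} (l , only) (dom , mate , match) | inj₂ (u , su , l~u) = subst S (only u l~u) su

  module Mates {S : Fin n → Set} (pm : HasPM S) where
    mate : Fin n → Fin n
    mate = proj₁ pm

    mate∈ : ∀ {v} → S v → S (mate v)
    mate∈ sv = proj₁ (proj₂ pm _ sv)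

    mate≢ : ∀ {v} → S v → mate v ≢ v
    mate≢ sv = proj₁ (proj₂ (proj₂ pm _ sv))

    mate-involutive : ∀ {v} → S v → mate (mate v) ≡ v
    mate-involutive sv = proj₁ (proj₂ (proj₂ (proj₂ pm _ sv)))

    mate~ : ∀ {v} → S v → v ~ mate v
    mate~ sv = proj₂ (proj₂ (proj₂ (proj₂ pm _ sv)))

    mate-edge : ∀ {v w} → S v → mate v ≡ w → v ~ w
    mate-edge sv e = subst (_ ~_) e (mate~ sv)

    mate-injective : ∀ {v w} → S v → S w → mate v ≡ mate w → v ≡ w
    mate-injective sv sw mv≡mw =
      trans (sym (mate-involutive sv)) (trans (cong mate mv≡mw) (mate-involutive sw))

    mate-avoids : ∀ {x y z} → S x → S z → mate x ≡ y → z ≢ x → z ≢ y → mate z ≢ x × mate z ≢ y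
    mate-avoids sx sz mx≡y z≢x z≢y =
      (λ mz≡x → z≢y (trans (sym (mate-involutive sz)) (trans (cong mate mz≡x) mx≡y))) ,
      (λ mz≡y → z≢x (mate-injective sz sx (trans mz≡y (sym mx≡y))))

    mate-in-pair : ∀ {x y} → S ⊆ Pair x y → S x → mate x ≡ y
    mate-in-pair S⊆ sx with S⊆ (mate∈ sx)
    ... | inj₁ mx≡x = ⊥-elim (mate≢ sx mx≡x)
    ... | inj₂ mx≡y = mx≡y

    stranded : ∀ {x y z} → S ⊆ Triple x y z → S x → S z → mate x ≡ y → z ≢ x → z ≢ y → ⊥
    stranded S⊆ sx sz mx≡y z≢x z≢y with mate-avoids sx sz mx≡y z≢x z≢y | S⊆ (mate∈ sz)
    ... | mz≢x , _ | inj₁ mz≡x        = mz≢x mz≡x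
    ... | _ , mz≢y | inj₂ (inj₁ mz≡y) = mz≢y mz≡y
    ... | _        | inj₂ (inj₂ mz≡z) = mate≢ sz mz≡z

    mate-completes-quad : ∀ {p q r t} → S ⊆ Quad p q r t → S p → S r →
                          mate p ≡ q → r ≢ p → r ≢ q → r ~ t
    mate-completes-quad S⊆ sp sr mp≡q r≢p r≢q with mate-avoids sp sr mp≡q r≢p r≢q
    ... | mr≢p , mr≢q with S⊆ (mate∈ sr)
    ...   | inj₁ mr≡p               = ⊥-elim (mr≢p mr≡p)
    ...   | inj₂ (inj₁ mr≡q)        = ⊥-elim (mr≢q mr≡q)
    ...   | inj₂ (inj₂ (inj₁ mr≡r)) = ⊥-elim (mate≢ sr mr≡r)
    ...   | inj₂ (inj₂ (inj₂ mr≡t)) = mate-edge sr mr≡t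

    quad-covered : ∀ {p q r t} → S ⊆ Quad p q r t → S p → S q → S r →
                   q ≢ p → r ≢ p → r ≢ q → q ≢ t → CoveredByTwoEdges p q r t
    quad-covered {p} {q} {r} {t} S⊆ sp sq sr q≢p r≢p r≢q q≢t with S⊆ (mate∈ sp)
    ... | inj₁ mp≡p               = ⊥-elim (mate≢ sp mp≡p)
    ... | inj₂ (inj₁ mp≡q)        = inj₁ (mate-edge sp mp≡q , mate-completes-quad S⊆ sp sr mp≡q r≢p r≢q)
    ... | inj₂ (inj₂ (inj₁ mp≡r)) =
      inj₂ (inj₁ (mate-edge sp mp≡r , mate-completes-quad (r-second ∘ S⊆) sp sq mp≡r q≢p (≢-sym r≢q)))
      where
      r-second : Quad p q r t ⊆ Quad p r q t
      r-second (inj₁ e)               = inj₁ e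
      r-second (inj₂ (inj₁ e))        = inj₂ (inj₂ (inj₁ e))
      r-second (inj₂ (inj₂ (inj₁ e))) = inj₂ (inj₁ e)
      r-second (inj₂ (inj₂ (inj₂ e))) = inj₂ (inj₂ (inj₂ e))
    ... | inj₂ (inj₂ (inj₂ mp≡t)) =
      inj₂ (inj₂ (mate-edge sp mp≡t , mate-completes-quad (t-second ∘ S⊆) sp sq mp≡t q≢p q≢t))
      where
      t-second : Quad p q r t ⊆ Quad p t q r
      t-second (inj₁ e)               = inj₁ e
      t-second (inj₂ (inj₁ e))        = inj₂ (inj₂ (inj₁ e))
      t-second (inj₂ (inj₂ (inj₁ e))) = inj₂ (inj₂ (inj₂ e))
      t-second (inj₂ (inj₂ (inj₂ e))) = inj₂ (inj₁ e)

  noPM-singleton : ∀ {S v} → S ⊆ (_≡ v) → S v → ¬ HasPM S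
  noPM-singleton S⊆ sv pm = mate≢ sv (trans (S⊆ (mate∈ sv)) (sym (S⊆ sv)))
    where open Mates pm

  noPM-triple : ∀ {S x y z} → S ⊆ Triple x y z → S x → S y → S z →
                x ≢ y → x ≢ z → y ≢ z → ¬ HasPM S
  noPM-triple {S} {x} {y} {z} S⊆ sx sy sz x≢y x≢z y≢z pm = odd (S⊆ (mate∈ sx))
    where
    open Mates pm
    odd : Triple x y z (mate x) → ⊥
    odd (inj₁ mx≡x)        = mate≢ sx mx≡x
    odd (inj₂ (inj₁ mx≡y)) = stranded S⊆ sx sz mx≡y (≢-sym x≢z) (≢-sym y≢z)
    odd (inj₂ (inj₂ mx≡z)) = stranded (reorder ∘ S⊆) sx sy mx≡z (≢-sym x≢y) y≢z
      where
      reorder : ∀ {w} → Triple x y z w → Triple x z y w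
      reorder (inj₁ e)        = inj₁ e
      reorder (inj₂ (inj₁ e)) = inj₂ (inj₂ e)
      reorder (inj₂ (inj₂ e)) = inj₂ (inj₁ e)

  pm-pair : ∀ {S x y} → S ⊆ Pair x y → S x → S y → x ~ y → HasPM S
  pm-pair {S} {x} {y} S⊆ sx sy x~y = transpose x y , matched
    where
    matched : ∀ v → S v → S (transpose x y v) × transpose x y v ≢ v ×
                          transpose x y (transpose x y v) ≡ v × v ~ transpose x y v
    matched v sv with S⊆ sv
    ... | inj₁ refl rewrite transpose-ˡ x y | transpose-ʳ x y = sy , ≢-sym (~⇒≢ x~y) , refl , x~y
    ... | inj₂ refl rewrite transpose-ʳ x y | transpose-ˡ x y = sx , ~⇒≢ x~y , refl , ~-sym x~y

  pm-quad : ∀ {S x y z t} → S ⊆ Quad x y z t → S x → S y → S z → S t →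
            x ≢ z → x ≢ t → y ≢ z → y ≢ t → x ~ y → z ~ t → HasPM S
  pm-quad {S} {x} {y} {z} {t} S⊆ sx sy sz st x≢z x≢t y≢z y≢t x~y z~t = mate , matched
    where
    mate : Fin n → Fin n
    mate w = transpose x y (transpose z t w)
    mate-x : mate x ≡ y
    mate-x rewrite transpose-other x≢z x≢t = transpose-ˡ x y
    mate-y : mate y ≡ x
    mate-y rewrite transpose-other y≢z y≢t = transpose-ʳ x y
    mate-z : mate z ≡ t
    mate-z rewrite transpose-ˡ z t = transpose-other (≢-sym x≢t) (≢-sym y≢t)
    mate-t : mate t ≡ z
    mate-t rewrite transpose-ʳ z t = transpose-other (≢-sym x≢z) (≢-sym y≢z)
    matched : ∀ v → S v → S (mate v) × mate v ≢ v × mate (mate v) ≡ v × v ~ mate v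
    matched v sv with S⊆ sv
    ... | inj₁ refl                 rewrite mate-x | mate-y = sy , ≢-sym (~⇒≢ x~y) , refl , x~y
    ... | inj₂ (inj₁ refl)          rewrite mate-y | mate-x = sx , ~⇒≢ x~y , refl , ~-sym x~y
    ... | inj₂ (inj₂ (inj₁ refl))   rewrite mate-z | mate-t = st , ≢-sym (~⇒≢ z~t) , refl , z~t
    ... | inj₂ (inj₂ (inj₂ refl))   rewrite mate-t | mate-z = sz , ~⇒≢ z~t , refl , ~-sym z~t

  dominating-edge⇒pd : ∀ {p q} → p ~ q → Dominates p q → PD (Pair p q)
  dominating-edge⇒pd {p} {q} p~q dominates = dom , pm-pair (λ s → s) (inj₁ refl) (inj₂ refl) p~q
    where
    dom : Dominating G (Pair p q)
    dom w with dominates w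
    ... | inj₁ w≡p                 = inj₁ (inj₁ w≡p)
    ... | inj₂ (inj₁ w≡q)          = inj₁ (inj₂ w≡q)
    ... | inj₂ (inj₂ (inj₁ w~p))   = inj₂ (p , inj₁ refl , w~p)
    ... | inj₂ (inj₂ (inj₂ w~q))   = inj₂ (q , inj₂ refl , w~q)

  pd⊆pair⇒dominating-edge : ∀ {S p q} → S ⊆ Pair p q → S p → PD S → p ~ q × Dominates p q
  pd⊆pair⇒dominating-edge {S} {p} {q} S⊆ sp (dom , pm) =
    mate-edge sp (mate-in-pair S⊆ sp) , dominates
    where
    open Mates pm
    dominates : Dominates p q
    dominates w with dom w
    ... | inj₁ sw with S⊆ sw
    ...   | inj₁ w≡p = inj₁ w≡p
    ...   | inj₂ w≡q = inj₂ (inj₁ w≡q)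
    dominates w | inj₂ (u , su , w~u) with S⊆ su
    ...   | inj₁ refl = inj₂ (inj₂ (inj₁ w~u))
    ...   | inj₂ refl = inj₂ (inj₂ (inj₂ w~u))

  pd-has-four : ∀ {S l a c} → PD S → S l → OnlyNeighbour l a → c ≢ a → ¬ a ~ c →
                Σ (Vec (Fin n) 4) λ vs → Unique vs × All S vs
  pd-has-four {S} {l} {a} {c} (dom , pm) sl only c≢a a≁c = four (dominator (dom c))
    where
    open Mates pm
    ml≡a : mate l ≡ a
    ml≡a = only (mate l) (mate~ sl)
    l~a : l ~ a
    l~a = mate-edge sl ml≡a
    dominator : S c ⊎ (Σ (Fin n) λ u → S u × c ~ u) → Σ (Fin n) λ w → S w × w ≢ a × w ≢ l
    dominator (inj₁ sc)             = c , sc , c≢a , λ { refl → a≁c (~-sym l~a) }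
    dominator (inj₂ (w , sw , c~w)) = w , sw , (λ { refl → a≁c (~-sym c~w) }) , λ { refl → c≢a (only c (~-sym c~w)) }
    four : (Σ (Fin n) λ w → S w × w ≢ a × w ≢ l) → Σ (Vec (Fin n) 4) λ vs → Unique vs × All S vs
    four (w , sw , w≢a , w≢l) with mate-avoids sl sw ml≡a w≢l w≢a
    ... | mw≢l , mw≢a =
      (l ∷ a ∷ w ∷ mate w ∷ []) ,
      ((l≢a ∷ ≢-sym w≢l ∷ ≢-sym mw≢l ∷ []) ∷ (≢-sym w≢a ∷ ≢-sym mw≢a ∷ []) ∷
       (≢-sym (mate≢ sw) ∷ []) ∷ [] ∷ []) ,
      (sl ∷ subst S ml≡a (mate∈ sl) ∷ sw ∷ mate∈ sw ∷ [])
      where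
      l≢a : l ≢ a
      l≢a l≡a = mate≢ sl (trans ml≡a (sym l≡a))

module Classes {n k : ℕ} (f : Fin n → Fin k) (nonempty : ∀ i → Σ (Fin n) λ v → f v ≡ i) where

  Class : Fin k → Fin n → Set
  Class i v = f v ≡ i

  rep : Fin k → Fin n
  rep i = proj₁ (nonempty i)

  f-rep : ∀ i → f (rep i) ≡ i
  f-rep i = proj₂ (nonempty i)

  rep-injective : ∀ {i j} → rep i ≡ rep j → i ≡ j
  rep-injective {i} {j} e = trans (sym (f-rep i)) (trans (cong f e) (f-rep j))

  IsSingleton : Fin k → Set
  IsSingleton i = ∀ {w} → f w ≡ i → w ≡ rep i

  singleton? : ∀ i → IsSingleton i ⊎ Σ (Fin n) λ w → f w ≡ i × w ≢ rep i
  singleton? i with Fin.any? (λ w → (f w ≟ᶠ i) ×-dec ¬? (w ≟ᶠ rep i))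
  ... | yes (w , fw≡i , w≢rep) = inj₂ (w , fw≡i , w≢rep)
  ... | no none = inj₁ λ {w} fw≡i → decidable-stable (w ≟ᶠ rep i) λ w≢rep → none (w , fw≡i , w≢rep)

  NonRep : Fin n → Set
  NonRep v = rep (f v) ≢ v

  nonRep : ∀ {v i} → f v ≡ i → v ≢ rep i → NonRep v
  nonRep refl v≢rep = ≢-sym v≢rep

  nonRep≢rep : ∀ {v} → NonRep v → ∀ i → rep i ≢ v
  nonRep≢rep nr i refl = nr (cong rep (f-rep i))

  nonReps+k≤n : ∀ {m} {vs : Vec (Fin n) m} → Unique vs → All NonRep vs → m + k ≤ n
  nonReps+k≤n {m} {vs} unique nonReps = Fin.injective⇒≤ {f = pick ∘ splitAt m} pick∘split-injective
    where
    pick : Fin m ⊎ Fin k → Fin n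
    pick = [ lookup vs , rep ]′
    pick-injective : ∀ a b → pick a ≡ pick b → a ≡ b
    pick-injective (inj₁ i) (inj₁ j) e = cong inj₁ (lookup-injective unique i j e)
    pick-injective (inj₁ i) (inj₂ j) e = ⊥-elim (nonRep≢rep (All.lookup⁺ nonReps i) j (sym e))
    pick-injective (inj₂ i) (inj₁ j) e = ⊥-elim (nonRep≢rep (All.lookup⁺ nonReps j) i e)
    pick-injective (inj₂ i) (inj₂ j) e = cong inj₂ (rep-injective e)
    pick∘split-injective : ∀ {i j} → pick (splitAt m i) ≡ pick (splitAt m j) → i ≡ j
    pick∘split-injective {i} {j} e = begin
      i                      ≡⟨ Fin.join-splitAt m k i ⟨
      join m k (splitAt m i) ≡⟨ cong (join m k) (pick-injective (splitAt m i) (splitAt m j) e) ⟩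
      join m k (splitAt m j) ≡⟨ Fin.join-splitAt m k j ⟩
      j                      ∎
      where open ≡-Reasoning

  two-nonReps⇒2+k≤n : ∀ {x y} → NonRep x → NonRep y → x ≢ y → 2 + k ≤ n
  two-nonReps⇒2+k≤n nx ny x≢y = nonReps+k≤n ((x≢y ∷ []) ∷ [] ∷ []) (nx ∷ ny ∷ [])

  three-nonReps⇒3+k≤n : ∀ {x y z} → NonRep x → NonRep y → NonRep z → x ≢ y → x ≢ z → y ≢ z → 3 + k ≤ n
  three-nonReps⇒3+k≤n nx ny nz x≢y x≢z y≢z =
    nonReps+k≤n ((x≢y ∷ x≢z ∷ []) ∷ (y≢z ∷ []) ∷ [] ∷ []) (nx ∷ ny ∷ nz ∷ [])

  nonRep-of-pair : ∀ {u v} → f u ≡ f v → u ≢ v → Σ (Fin n) λ w → NonRep w × Pair u v w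
  nonRep-of-pair {u} {v} fu≡fv u≢v with rep (f u) ≟ᶠ u
  ... | no nu    = u , nu , inj₁ refl
  ... | yes ru≡u = v , (λ rv≡v → u≢v (trans (sym ru≡u) (trans (cong rep fu≡fv) rv≡v))) , inj₂ refl

  nonRep-of-three : ∀ {i j x y z} → Pair i j (f x) → Pair i j (f y) → Pair i j (f z) →
                    x ≢ y → x ≢ z → y ≢ z → Σ (Fin n) λ w → NonRep w × Triple x y z w
  nonRep-of-three cx cy cz x≢y x≢z y≢z with two-of-three cx cy cz
  ... | inj₁ fx≡fy        = map₂ (map₂ [ inj₁ , inj₂ ∘ inj₁ ]′) (nonRep-of-pair fx≡fy x≢y)
  ... | inj₂ (inj₁ fx≡fz) = map₂ (map₂ [ inj₁ , inj₂ ∘ inj₂ ]′) (nonRep-of-pair fx≡fz x≢z)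
  ... | inj₂ (inj₂ fy≡fz) = map₂ (map₂ (inj₂ ∘ [ inj₁ , inj₂ ]′)) (nonRep-of-pair fy≡fz y≢z)

  another-nonRep : ∀ {w a b c} → NonRep w → ¬ Triple a b c w →
            Σ (Fin n) (λ w′ → NonRep w′ × Triple a b c w′) → 2 + k ≤ n
  another-nonRep nw w∉ (w′ , nw′ , w′∈) = two-nonReps⇒2+k≤n nw nw′ λ { refl → w∉ w′∈ }

  four-in-two-classes⇒2+k≤n : ∀ {i j} {vs : Vec (Fin n) 4} → Unique vs → All (λ v → Pair i j (f v)) vs → 2 + k ≤ n
  four-in-two-classes⇒2+k≤n ((x≢y ∷ x≢z ∷ x≢t ∷ []) ∷ (y≢z ∷ y≢t ∷ []) ∷ (z≢t ∷ []) ∷ [] ∷ [])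
                            (cx ∷ cy ∷ cz ∷ ct ∷ [])
    with nonRep-of-three cx cy cz x≢y x≢z y≢z
  ... | w , nw , inj₁ refl        =
    another-nonRep nw (∉-triple x≢y x≢z x≢t) (nonRep-of-three cy cz ct y≢z y≢t z≢t)
  ... | w , nw , inj₂ (inj₁ refl) =
    another-nonRep nw (∉-triple (≢-sym x≢y) y≢z y≢t) (nonRep-of-three cx cz ct x≢z x≢t z≢t)
  ... | w , nw , inj₂ (inj₂ refl) =
    another-nonRep nw (∉-triple (≢-sym x≢z) (≢-sym y≢z) z≢t) (nonRep-of-three cx cy ct x≢y x≢t y≢t)

  other-member : ∀ {i} → (Σ (Fin n) λ w → f w ≡ i × w ≢ rep i) → ∀ z → Σ (Fin n) λ x → f x ≡ i × x ≢ z
  other-member {i} (w , fw≡i , w≢rep) z with z ≟ᶠ rep i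
  ... | yes z≡rep = w , fw≡i , λ w≡z → w≢rep (trans w≡z z≡rep)
  ... | no z≢rep  = rep i , f-rep i , ≢-sym z≢rep

  different-classes : ∀ {w w′ i j} → f w ≡ i → f w′ ≡ j → i ≢ j → w ≢ w′
  different-classes fw fw′ i≢j refl = i≢j (trans (sym fw) fw′)

  same-singleton : ∀ {i w w′} → IsSingleton i → f w ≡ i → f w′ ≡ i → w ≡ w′
  same-singleton single fw fw′ = trans (single fw) (sym (single fw′))

  private
    moved : ∀ {u x r : Fin n} → u ≡ r → u ≢ x → x ≢ r
    moved u≡r u≢x x≡r = u≢x (trans u≡r (sym x≡r))

  nonReps-of-triple : ∀ {i u x y} → f u ≡ i → f x ≡ i → f y ≡ i → u ≢ x → u ≢ y → x ≢ y →
                      Σ (Fin n) λ p → Σ (Fin n) λ q → NonRep p × NonRep q × p ≢ q × f p ≡ i × f q ≡ i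
  nonReps-of-triple {i} {u} {x} {y} fu fx fy u≢x u≢y x≢y with u ≟ᶠ rep i | x ≟ᶠ rep i
  ... | yes u≡r | _       = x , y , nonRep fx (moved u≡r u≢x) , nonRep fy (moved u≡r u≢y) , x≢y , fx , fy
  ... | no u≢r  | yes x≡r = u , y , nonRep fu u≢r , nonRep fy (moved x≡r x≢y) , u≢y , fu , fy
  ... | no u≢r  | no x≢r  = u , x , nonRep fu u≢r , nonRep fx x≢r , u≢x , fu , fx

  four-in-class⇒3+k≤n : ∀ {i u x y z} → f u ≡ i → f x ≡ i → f y ≡ i → f z ≡ i →
                  u ≢ x → u ≢ y → u ≢ z → x ≢ y → x ≢ z → y ≢ z → 3 + k ≤ n
  four-in-class⇒3+k≤n {i} {u} {x} {y} fu fx fy fz u≢x u≢y u≢z x≢y x≢z y≢z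
    with u ≟ᶠ rep i | x ≟ᶠ rep i | y ≟ᶠ rep i
  ... | yes u≡r | _       | _       =
    three-nonReps⇒3+k≤n (nonRep fx (moved u≡r u≢x)) (nonRep fy (moved u≡r u≢y)) (nonRep fz (moved u≡r u≢z))
                        x≢y x≢z y≢z
  ... | no u≢r  | yes x≡r | _       =
    three-nonReps⇒3+k≤n (nonRep fu u≢r) (nonRep fy (moved x≡r x≢y)) (nonRep fz (moved x≡r x≢z)) u≢y u≢z y≢z
  ... | no u≢r  | no x≢r  | yes y≡r =
    three-nonReps⇒3+k≤n (nonRep fu u≢r) (nonRep fx x≢r) (nonRep fz (moved y≡r y≢z)) u≢x u≢z x≢z
  ... | no u≢r  | no x≢r  | no y≢r  =
    three-nonReps⇒3+k≤n (nonRep fu u≢r) (nonRep fx x≢r) (nonRep fy y≢r) u≢x u≢y x≢y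

  triple-and-pair⇒3+k≤n : ∀ {i u x y z z′} → f u ≡ i → f x ≡ i → f y ≡ i → u ≢ x → u ≢ y → x ≢ y →
                    f z ≡ f z′ → z ≢ z′ → f z ≢ i → 3 + k ≤ n
  triple-and-pair⇒3+k≤n {i} {z = z} {z′} fu fx fy u≢x u≢y x≢y fz≡fz′ z≢z′ fz≢i
    with nonReps-of-triple fu fx fy u≢x u≢y x≢y | nonRep-of-pair fz≡fz′ z≢z′
  ... | p , q , np , nq , p≢q , fp , fq | r , nr , r∈ =
    three-nonReps⇒3+k≤n np nq nr p≢q (apart fp (outside r∈)) (apart fq (outside r∈))
    where
    outside : ∀ {w} → Pair z z′ w → f w ≢ i
    outside (inj₁ refl) = fz≢i
    outside (inj₂ refl) = λ fz′≡i → fz≢i (trans fz≡fz′ fz′≡i)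
    apart : ∀ {w w′} → f w ≡ i → f w′ ≢ i → w ≢ w′
    apart fw fw′≢i refl = fw′≢i fw

-- Merges a, b and c: b and c are punched out and sent to the image of a.
module Collapse {m : ℕ} {a b c : Fin (2 + m)} (a≢b : a ≢ b) (a≢c : a ≢ c) (b≢c : b ≢ c) where
  private
    c′ : Fin (suc m)
    c′ = punchOut b≢c

    index : ∀ {v} → b ≢ v → c ≢ v → Fin m
    index b≢v c≢v = punchOut {i = c′} (c≢v ∘ Fin.punchOut-injective b≢c b≢v)

    index-irrelevant : ∀ {v} (b≢v b≢v′ : b ≢ v) (c≢v c≢v′ : c ≢ v) → index b≢v c≢v ≡ index b≢v′ c≢v′
    index-irrelevant _ _ _ _ = Fin.punchOut-cong c′ (Fin.punchOut-cong b refl)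

    index-injective : ∀ {v w} (b≢v : b ≢ v) (c≢v : c ≢ v) (b≢w : b ≢ w) (c≢w : c ≢ w) →
                      index b≢v c≢v ≡ index b≢w c≢w → v ≡ w
    index-injective b≢v c≢v b≢w c≢w e = Fin.punchOut-injective b≢v b≢w
      (Fin.punchOut-injective {i = c′} (c≢v ∘ Fin.punchOut-injective b≢c b≢v) (c≢w ∘ Fin.punchOut-injective b≢c b≢w) e)

    index-a : Fin m
    index-a = index (≢-sym a≢b) (≢-sym a≢c)

  collapse : Fin (2 + m) → Fin m
  collapse v with b ≟ᶠ v | c ≟ᶠ v
  ... | no b≢v | no c≢v = index b≢v c≢v
  ... | _      | _      = index-a

  collapse-index : ∀ {v} (b≢v : b ≢ v) (c≢v : c ≢ v) → collapse v ≡ index b≢v c≢v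
  collapse-index {v} b≢v c≢v with b ≟ᶠ v | c ≟ᶠ v
  ... | yes b≡v | _       = ⊥-elim (b≢v b≡v)
  ... | no _    | yes c≡v = ⊥-elim (c≢v c≡v)
  ... | no b≢v′  | no c≢v′ = index-irrelevant b≢v′ b≢v c≢v′ c≢v

  private
    collapse-a : collapse a ≡ index-a
    collapse-a = collapse-index (≢-sym a≢b) (≢-sym a≢c)

  collapse-b : collapse b ≡ collapse a
  collapse-b with b ≟ᶠ b
  ... | yes _   = sym collapse-a
  ... | no b≢b  = ⊥-elim (b≢b refl)

  collapse-c : collapse c ≡ collapse a
  collapse-c with b ≟ᶠ c | c ≟ᶠ c
  ... | yes _ | _      = sym collapse-a
  ... | no _  | yes _  = sym collapse-a
  ... | no _  | no c≢c = ⊥-elim (c≢c refl)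

  collapse-fibre-a : ∀ {w} → collapse w ≡ collapse a → Triple a b c w
  collapse-fibre-a {w} e with b ≟ᶠ w | c ≟ᶠ w
  ... | yes b≡w | _       = inj₂ (inj₁ (sym b≡w))
  ... | no _    | yes c≡w = inj₂ (inj₂ (sym c≡w))
  ... | no b≢w  | no c≢w  =
    inj₁ (index-injective b≢w c≢w (≢-sym a≢b) (≢-sym a≢c) (trans e collapse-a))

  private
    outside-b : ∀ {v} → ¬ Triple a b c v → b ≢ v
    outside-b v∉ b≡v = v∉ (inj₂ (inj₁ (sym b≡v)))

    outside-c : ∀ {v} → ¬ Triple a b c v → c ≢ v
    outside-c v∉ c≡v = v∉ (inj₂ (inj₂ (sym c≡v)))

    collapse-outside : ∀ {v} (v∉ : ¬ Triple a b c v) → collapse v ≡ index (outside-b v∉) (outside-c v∉)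
    collapse-outside v∉ = collapse-index (outside-b v∉) (outside-c v∉)

    index-a≢outside : ∀ {v} → ¬ Triple a b c v → index-a ≢ collapse v
    index-a≢outside v∉ e =
      v∉ (inj₁ (sym (index-injective (≢-sym a≢b) (≢-sym a≢c) (outside-b v∉) (outside-c v∉) (trans e (collapse-outside v∉)))))

  collapse-fibre-other : ∀ {v w} → ¬ Triple a b c v → collapse w ≡ collapse v → w ≡ v
  collapse-fibre-other {v} {w} v∉ e with b ≟ᶠ w | c ≟ᶠ w
  ... | yes _   | _       = ⊥-elim (index-a≢outside v∉ e)
  ... | no _    | yes _   = ⊥-elim (index-a≢outside v∉ e)
  ... | no b≢w  | no c≢w  = index-injective b≢w c≢w (outside-b v∉) (outside-c v∉) (trans e (collapse-outside v∉))

  collapse-surjective : ∀ i → Σ (Fin (2 + m)) λ v → collapse v ≡ i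
  collapse-surjective i = v , (begin
    collapse v                                   ≡⟨ collapse-index b≢v c≢v ⟩
    index b≢v c≢v                                ≡⟨ Fin.punchOut-cong c′ b-removed ⟩
    punchOut {i = c′} (Fin.punchInᵢ≢i c′ i ∘ sym) ≡⟨ Fin.punchOut-punchIn c′ ⟩
    i                                            ∎)
    where
    open ≡-Reasoning
    v : Fin (2 + m)
    v = punchIn b (punchIn c′ i)
    b≢v : b ≢ v
    b≢v = Fin.punchInᵢ≢i b (punchIn c′ i) ∘ sym
    c≢v : c ≢ v
    c≢v c≡v = Fin.punchInᵢ≢i c′ i (sym (Fin.punchIn-injective b c′ (punchIn c′ i)
                                          (trans (Fin.punchIn-punchOut b≢c) c≡v)))
    b-removed : punchOut b≢v ≡ punchIn c′ i
    b-removed = trans (Fin.punchOut-cong b refl) (Fin.punchOut-punchIn b)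

module Shapes {n : ℕ} (G : Graph n) where
  open Basics G

  data Shape : Set where
    dominating-edge : ∀ {p q} → p ~ q → Dominates p q → ¬ (IsSupport p × IsSupport q) → Shape
    path            : ∀ {t₁ t₂ t₃} → t₁ ≢ t₃ → t₁ ~ t₂ → t₂ ~ t₃ →
                      (∀ v → v ≢ t₁ → v ≢ t₂ → v ≢ t₃ → v ~ t₁ ⊎ v ~ t₃) → Shape
    edge-and-vertex : ∀ {t₁ t₂ t₃} → t₂ ~ t₃ → (∀ v → v ≢ t₁ → v ≢ t₂ → v ≢ t₃ → v ~ t₁) → Shape

  matched-triple⇒shape : TriangleFree → ∀ {u x y} → u ≢ x → u ≢ y → x ~ y →
                         (∀ v → v ≢ u → v ≢ x → v ≢ y → CoveredByTwoEdges v u x y) → Shape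
  matched-triple⇒shape triangle-free {u} {x} {y} u≢x u≢y x~y matched with u ~? x | u ~? y
  ... | yes u~x | yes u~y = ⊥-elim (triangle-free u~x x~y (~-sym u~y))
  ... | yes u~x | no u≁y  = path u≢y u~x x~y λ v v≢u v≢x v≢y → ends (matched v v≢u v≢x v≢y)
    where
    ends : ∀ {v} → CoveredByTwoEdges v u x y → v ~ u ⊎ v ~ y
    ends (inj₁ (v~u , _))        = inj₁ v~u
    ends (inj₂ (inj₁ (_ , u~y))) = ⊥-elim (u≁y u~y)
    ends (inj₂ (inj₂ (v~y , _))) = inj₂ v~y
  ... | no u≁x  | yes u~y = path u≢x u~y (~-sym x~y) λ v v≢u v≢y v≢x → ends (matched v v≢u v≢x v≢y)
    where
    ends : ∀ {v} → CoveredByTwoEdges v u x y → v ~ u ⊎ v ~ x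
    ends (inj₁ (v~u , _))        = inj₁ v~u
    ends (inj₂ (inj₁ (v~x , _))) = inj₂ v~x
    ends (inj₂ (inj₂ (_ , u~x))) = ⊥-elim (u≁x u~x)
  ... | no u≁x  | no u≁y  = edge-and-vertex x~y λ v v≢u v≢x v≢y → centre (matched v v≢u v≢x v≢y)
    where
    centre : ∀ {v} → CoveredByTwoEdges v u x y → v ~ u
    centre (inj₁ (v~u , _))        = v~u
    centre (inj₂ (inj₁ (_ , u~y))) = ⊥-elim (u≁y u~y)
    centre (inj₂ (inj₂ (_ , u~x))) = ⊥-elim (u≁x u~x)

module PcClasses {n : ℕ} (G : Graph n) {k : ℕ} (P : PcPartition G k) where
  open Basics G
  open PairedDomination G
  open Shapes G

  f : Fin n → Fin k
  f = proj₁ P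

  open Classes f (proj₁ (proj₂ P)) public

  partner : ∀ i → Σ (Fin k) λ j → j ≢ i × PD (Class i ∪ Class j)
  partner = proj₂ (proj₂ (proj₂ P))

  supports-share-class : 3 ≤ k → ∀ {p q} → IsSupport p → IsSupport q → f p ≡ f q
  supports-share-class 3≤k {p} {q} sp sq with avoid-two 3≤k (f p) (f q)
  ... | i , i≢fp , i≢fq with partner i
  ...   | j , _ , pd with support∈pd sp pd | support∈pd sq pd
  ...     | inj₁ fp≡i | _         = ⊥-elim (i≢fp (sym fp≡i))
  ...     | inj₂ _    | inj₁ fq≡i = ⊥-elim (i≢fq (sym fq≡i))
  ...     | inj₂ fp≡j | inj₂ fq≡j = trans fp≡j (sym fq≡j)

  singletons⇒dominating-edge : 3 ≤ k → ∀ {i j} → IsSingleton i → IsSingleton j → j ≢ i →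
                               PD (Class i ∪ Class j) → Shape
  singletons⇒dominating-edge 3≤k {i} {j} single-i single-j j≢i pd
    with pd⊆pair⇒dominating-edge S⊆pair (inj₁ (f-rep i)) pd
    where
    S⊆pair : Class i ∪ Class j ⊆ Pair (rep i) (rep j)
    S⊆pair (inj₁ e) = inj₁ (single-i e)
    S⊆pair (inj₂ e) = inj₂ (single-j e)
  ... | edge , dominates = dominating-edge edge dominates λ (sp , sq) →
    j≢i (trans (sym (f-rep j)) (trans (sym (supports-share-class 3≤k sp sq)) (f-rep i)))

  leaf-and-nonneighbour⇒2+k≤n : ∀ {l a c} → OnlyNeighbour l a → c ≢ a → ¬ a ~ c → 2 + k ≤ n
  leaf-and-nonneighbour⇒2+k≤n {l} only c≢a a≁c with partner (f l)
  ... | _ , _ , pd with pd-has-four pd (inj₁ refl) only c≢a a≁c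
  ...   | _ , unique , members = four-in-two-classes⇒2+k≤n unique members

module Tight {n : ℕ} (G : Graph n) (triangle-free : Basics.TriangleFree G)
             {k : ℕ} (P : PcPartition G k) (3≤k : 3 ≤ k) (tight : ¬ 3 + k ≤ n) where
  -- tight: at most two vertices are not the representative of their class.
  open Basics G
  open PairedDomination G
  open Shapes G
  open PcClasses G P

  singleton-class : Σ (Fin k) IsSingleton
  singleton-class with three-distinct 3≤k
  ... | i₀ , i₁ , i₂ , i₀≢i₁ , i₀≢i₂ , i₁≢i₂ with singleton? i₀ | singleton? i₁ | singleton? i₂
  ...   | inj₁ single | _           | _           = i₀ , single
  ...   | inj₂ _      | inj₁ single | _           = i₁ , single
  ...   | inj₂ _      | inj₂ _      | inj₁ single = i₂ , single
  ...   | inj₂ (w₀ , f₀ , n₀) | inj₂ (w₁ , f₁ , n₁) | inj₂ (w₂ , f₂ , n₂) =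
    ⊥-elim (tight (three-nonReps⇒3+k≤n (nonRep f₀ n₀) (nonRep f₁ n₁) (nonRep f₂ n₂)
      (different-classes f₀ f₁ i₀≢i₁) (different-classes f₀ f₂ i₀≢i₂) (different-classes f₁ f₂ i₁≢i₂)))

  module SingletonPartner (i₀ : Fin k) (single : IsSingleton i₀) where
    j₀ : Fin k
    j₀ = proj₁ (partner i₀)

    j₀≢i₀ : j₀ ≢ i₀
    j₀≢i₀ = proj₁ (proj₂ (partner i₀))

    pd₀ : PD (Class i₀ ∪ Class j₀)
    pd₀ = proj₂ (proj₂ (partner i₀))

    open Mates (proj₂ pd₀)

    v₀∈ : (Class i₀ ∪ Class j₀) (rep i₀)
    v₀∈ = inj₁ (f-rep i₀)

    u : Fin n
    u = mate (rep i₀)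

    fu≡j₀ : f u ≡ j₀
    fu≡j₀ with mate∈ v₀∈
    ... | inj₁ fu≡i₀ = ⊥-elim (mate≢ v₀∈ (single fu≡i₀))
    ... | inj₂ fu≡j₀ = fu≡j₀

    module LargePartner (x : Fin n) (fx≡j₀ : f x ≡ j₀) (x≢u : x ≢ u) where
      x∈ : (Class i₀ ∪ Class j₀) x
      x∈ = inj₂ fx≡j₀

      y : Fin n
      y = mate x

      y≢v₀ : y ≢ rep i₀
      y≢v₀ y≡v₀ = x≢u (trans (sym (mate-involutive x∈)) (cong mate y≡v₀))

      y≢u : y ≢ u
      y≢u y≡u = j₀≢i₀ (trans (sym fx≡j₀) (trans (cong f (mate-injective x∈ v₀∈ y≡u)) (f-rep i₀)))

      fy≡j₀ : f y ≡ j₀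
      fy≡j₀ with mate∈ x∈
      ... | inj₁ fy≡i₀ = ⊥-elim (y≢v₀ (single fy≡i₀))
      ... | inj₂ fy≡j₀ = fy≡j₀

      u≢x : u ≢ x
      u≢x = ≢-sym x≢u

      u≢y : u ≢ y
      u≢y = ≢-sym y≢u

      x≢y : x ≢ y
      x≢y = ≢-sym (mate≢ x∈)

      class-j₀ : ∀ {z} → f z ≡ j₀ → Triple u x y z
      class-j₀ {z} fz≡j₀ with z ≟ᶠ u | z ≟ᶠ x | z ≟ᶠ y
      ... | yes z≡u | _       | _       = inj₁ z≡u
      ... | no _    | yes z≡x | _       = inj₂ (inj₁ z≡x)
      ... | no _    | no _    | yes z≡y = inj₂ (inj₂ z≡y)
      ... | no z≢u  | no z≢x  | no z≢y  = ⊥-elim (tight (four-in-class⇒3+k≤n fu≡j₀ fx≡j₀ fy≡j₀ fz≡j₀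
                                            u≢x u≢y (≢-sym z≢u) x≢y (≢-sym z≢x) (≢-sym z≢y)))

      others-singleton : ∀ {i} → i ≢ j₀ → IsSingleton i
      others-singleton {i} i≢j₀ {w} fw≡i with w ≟ᶠ rep i
      ... | yes w≡rep = w≡rep
      ... | no w≢rep  = ⊥-elim (tight (triple-and-pair⇒3+k≤n fu≡j₀ fx≡j₀ fy≡j₀ u≢x u≢y x≢y
                          (trans fw≡i (sym (f-rep i))) w≢rep λ fw≡j₀ → i≢j₀ (trans (sym fw≡i) fw≡j₀)))

      outside-class : ∀ {v} → v ≢ u → v ≢ x → v ≢ y → f v ≢ j₀
      outside-class v≢u v≢x v≢y fv≡j₀ = ∉-triple v≢u v≢x v≢y (class-j₀ fv≡j₀)

      covered : ∀ {v} → v ≢ u → v ≢ x → v ≢ y → ∀ {j} → j ≡ j₀ →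
                PD (Class (f v) ∪ Class j) → CoveredByTwoEdges v u x y
      covered {v} v≢u v≢x v≢y refl (_ , pm) =
        Mates.quad-covered pm S⊆quad (inj₁ refl) (inj₂ fu≡j₀) (inj₂ fx≡j₀) (≢-sym v≢u) (≢-sym v≢x) x≢u u≢y
        where
        S⊆quad : Class (f v) ∪ Class j₀ ⊆ Quad v u x y
        S⊆quad (inj₁ e) = inj₁ (same-singleton (others-singleton (outside-class v≢u v≢x v≢y)) e refl)
        S⊆quad (inj₂ e) = inj₂ (class-j₀ e)

      shape : Shape
      shape with Fin.any? (λ v → ¬? (f v ≟ᶠ j₀) ×-dec ¬? (proj₁ (partner (f v)) ≟ᶠ j₀))
      ... | yes (v , fv≢j₀ , j≢j₀) = singletons⇒dominating-edge 3≤k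
              (others-singleton fv≢j₀) (others-singleton j≢j₀)
              (proj₁ (proj₂ (partner (f v)))) (proj₂ (proj₂ (partner (f v))))
      ... | no none = matched-triple⇒shape triangle-free u≢x u≢y (mate~ x∈) λ v v≢u v≢x v≢y →
              covered v≢u v≢x v≢y (partner-is-j₀ (outside-class v≢u v≢x v≢y)) (proj₂ (proj₂ (partner (f v))))
        where
        partner-is-j₀ : ∀ {v} → f v ≢ j₀ → proj₁ (partner (f v)) ≡ j₀
        partner-is-j₀ {v} fv≢j₀ =
          decidable-stable (proj₁ (partner (f v)) ≟ᶠ j₀) λ j≢j₀ → none (v , fv≢j₀ , j≢j₀)

    shape : Shape
    shape with singleton? j₀
    ... | inj₁ single-j₀ = singletons⇒dominating-edge 3≤k single single-j₀ j₀≢i₀ pd₀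
    ... | inj₂ large with other-member large u
    ...   | x , fx≡j₀ , x≢u = LargePartner.shape x fx≡j₀ x≢u

  shape : Shape
  shape = SingletonPartner.shape (proj₁ singleton-class) (proj₂ singleton-class)

module Squares {n : ℕ} (G : Graph n) (triangle-free : Basics.TriangleFree G) where
  open Basics G
  open Shapes G

  record Square : Set where
    field
      a b c d : Fin n
      a≢b : a ≢ b
      a≢c : a ≢ c
      a≢d : a ≢ d
      b≢c : b ≢ c
      b≢d : b ≢ d
      c≢d : c ≢ d
      a~b : a ~ b
      b~c : b ~ c
      c~d : c ~ d
      d~a : d ~ a
      -- unicyclicity, in the only form used
      cycles-on-square : ∀ (C : Cycle G) i → Quad a b c d (Cycle.vert C i)

  module Corners (s : Square) where
    open Square s public

    On : Fin n → Set
    On = Quad a b c d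

    Off : Fin n → Set
    Off x = x ≢ a × x ≢ b × x ≢ c × x ≢ d

    a≁c : ¬ a ~ c
    a≁c a~c = triangle-free a~b b~c (~-sym a~c)

    c≢a-neighbour : ∀ {t} → a ~ t → c ≢ t
    c≢a-neighbour a~t c≡t = a≁c (subst (a ~_) (sym c≡t) a~t)

    b≁d : ¬ b ~ d
    b≁d b~d = triangle-free b~c c~d (~-sym b~d)

    off? : ∀ x → Dec (Off x)
    off? x = ¬? (x ≟ᶠ a) ×-dec ¬? (x ≟ᶠ b) ×-dec ¬? (x ≟ᶠ c) ×-dec ¬? (x ≟ᶠ d)

    on-or-off : ∀ x → On x ⊎ Off x
    on-or-off x with x ≟ᶠ a | x ≟ᶠ b | x ≟ᶠ c | x ≟ᶠ d
    ... | yes x≡a | _       | _       | _       = inj₁ (inj₁ x≡a)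
    ... | no _    | yes x≡b | _       | _       = inj₁ (inj₂ (inj₁ x≡b))
    ... | no _    | no _    | yes x≡c | _       = inj₁ (inj₂ (inj₂ (inj₁ x≡c)))
    ... | no _    | no _    | no _    | yes x≡d = inj₁ (inj₂ (inj₂ (inj₂ x≡d)))
    ... | no x≢a  | no x≢b  | no x≢c  | no x≢d  = inj₂ (x≢a , x≢b , x≢c , x≢d)

    off≢on : ∀ {x y} → Off x → On y → x ≢ y
    off≢on (x≢a , _ , _ , _) (inj₁ refl)                = x≢a
    off≢on (_ , x≢b , _ , _) (inj₂ (inj₁ refl))         = x≢b
    off≢on (_ , _ , x≢c , _) (inj₂ (inj₂ (inj₁ refl)))  = x≢c
    off≢on (_ , _ , _ , x≢d) (inj₂ (inj₂ (inj₂ refl)))  = x≢d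

    off-not-on-cycle : ∀ {x} → Off x → (C : Cycle G) → ∀ i → Cycle.vert C i ≢ x
    off-not-on-cycle off-x C i e = off≢on off-x (cycles-on-square C i) (sym e)

    corners : Vec (Fin n) 4
    corners = a ∷ b ∷ c ∷ d ∷ []

    corners-unique : Unique corners
    corners-unique = (a≢b ∷ a≢c ∷ a≢d ∷ []) ∷ (b≢c ∷ b≢d ∷ []) ∷ (c≢d ∷ []) ∷ [] ∷ []

    4≤n : 4 ≤ n
    4≤n = unique⇒≤ corners-unique

    off⇒5≤n : Σ (Fin n) Off → 5 ≤ n
    off⇒5≤n (v , v≢a , v≢b , v≢c , v≢d) =
      unique⇒≤ {vs = v ∷ corners} ((v≢a ∷ v≢b ∷ v≢c ∷ v≢d ∷ []) ∷ corners-unique)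

    corner-on : ∀ i → On (lookup corners i)
    corner-on zero                   = inj₁ refl
    corner-on (suc zero)             = inj₂ (inj₁ refl)
    corner-on (suc (suc zero))       = inj₂ (inj₂ (inj₁ refl))
    corner-on (suc (suc (suc zero))) = inj₂ (inj₂ (inj₂ refl))

    corner-index : ∀ {x} → On x → Fin 4
    corner-index (inj₁ _)                = zero
    corner-index (inj₂ (inj₁ _))         = suc zero
    corner-index (inj₂ (inj₂ (inj₁ _)))  = suc (suc zero)
    corner-index (inj₂ (inj₂ (inj₂ _)))  = suc (suc (suc zero))

    lookup-corner-index : ∀ {x} (on : On x) → lookup corners (corner-index on) ≡ x
    lookup-corner-index (inj₁ e)                = sym e
    lookup-corner-index (inj₂ (inj₁ e))         = sym e
    lookup-corner-index (inj₂ (inj₂ (inj₁ e)))  = sym e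
    lookup-corner-index (inj₂ (inj₂ (inj₂ e)))  = sym e

    all-on⇒n≤4 : (∀ x → On x) → n ≤ 4
    all-on⇒n≤4 all-on = Fin.injective⇒≤ {f = λ x → corner-index (all-on x)} λ {x} {y} e →
      trans (sym (lookup-corner-index (all-on x))) (trans (cong (lookup corners) e) (lookup-corner-index (all-on y)))

    data Position (y z : Fin n) : Set where
      same     : y ≡ z → Position y z
      adjacent : y ~ z → Position y z
      opposite : ∀ {t} → y ≢ z → y ~ t → t ~ z → On t → Position y z

    position : ∀ {y z} → On y → On z → Position y z
    position (inj₁ refl)               (inj₁ refl)               = same refl
    position (inj₁ refl)               (inj₂ (inj₁ refl))        = adjacent a~b
    position (inj₁ refl)               (inj₂ (inj₂ (inj₁ refl))) = opposite a≢c a~b b~c (inj₂ (inj₁ refl))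
    position (inj₁ refl)               (inj₂ (inj₂ (inj₂ refl))) = adjacent (~-sym d~a)
    position (inj₂ (inj₁ refl))        (inj₁ refl)               = adjacent (~-sym a~b)
    position (inj₂ (inj₁ refl))        (inj₂ (inj₁ refl))        = same refl
    position (inj₂ (inj₁ refl))        (inj₂ (inj₂ (inj₁ refl))) = adjacent b~c
    position (inj₂ (inj₁ refl))        (inj₂ (inj₂ (inj₂ refl))) = opposite b≢d b~c c~d (inj₂ (inj₂ (inj₁ refl)))
    position (inj₂ (inj₂ (inj₁ refl))) (inj₁ refl)               = opposite (≢-sym a≢c) (~-sym b~c) (~-sym a~b) (inj₂ (inj₁ refl))
    position (inj₂ (inj₂ (inj₁ refl))) (inj₂ (inj₁ refl))        = adjacent (~-sym b~c)
    position (inj₂ (inj₂ (inj₁ refl))) (inj₂ (inj₂ (inj₁ refl))) = same refl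
    position (inj₂ (inj₂ (inj₁ refl))) (inj₂ (inj₂ (inj₂ refl))) = adjacent c~d
    position (inj₂ (inj₂ (inj₂ refl))) (inj₁ refl)               = adjacent d~a
    position (inj₂ (inj₂ (inj₂ refl))) (inj₂ (inj₁ refl))        = opposite (≢-sym b≢d) (~-sym c~d) (~-sym b~c) (inj₂ (inj₂ (inj₁ refl)))
    position (inj₂ (inj₂ (inj₂ refl))) (inj₂ (inj₂ (inj₁ refl))) = adjacent (~-sym c~d)
    position (inj₂ (inj₂ (inj₂ refl))) (inj₂ (inj₂ (inj₂ refl))) = same refl

    -- Otherwise a triangle, or a second cycle through an off-square vertex, appears.
    off-sees-one-corner : ∀ {x y z} → Off x → x ~ y → x ~ z → On y → On z → y ≡ z
    off-sees-one-corner {x} {y} {z} off-x x~y x~z on-y on-z with position on-y on-z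
    ... | same y≡z      = y≡z
    ... | adjacent y~z  = ⊥-elim (triangle-free x~y y~z (~-sym x~z))
    ... | opposite {t} y≢z y~t t~z on-t =
      ⊥-elim (off-not-on-cycle off-x (quadrangle unique x~y y~t t~z (~-sym x~z)) zero refl)
      where
      unique : Unique (x ∷ y ∷ t ∷ z ∷ [])
      unique = (off≢on off-x on-y ∷ off≢on off-x on-t ∷ off≢on off-x on-z ∷ [])
             ∷ (~⇒≢ y~t ∷ y≢z ∷ []) ∷ (~⇒≢ t~z ∷ []) ∷ [] ∷ []

    off-edge-detached : ∀ {x w y z} → Off x → Off w → x ~ w → x ~ y → w ~ z → On y → On z → ⊥
    off-edge-detached {x} {w} {y} {z} off-x off-w x~w x~y w~z on-y on-z with position on-y on-z
    ... | same refl    = triangle-free x~w w~z (~-sym x~y)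
    ... | adjacent y~z = off-not-on-cycle off-x (quadrangle unique x~y y~z (~-sym w~z) (~-sym x~w)) zero refl
      where
      unique : Unique (x ∷ y ∷ z ∷ w ∷ [])
      unique = (off≢on off-x on-y ∷ off≢on off-x on-z ∷ ~⇒≢ x~w ∷ [])
             ∷ (~⇒≢ y~z ∷ ≢-sym (off≢on off-w on-y) ∷ []) ∷ (≢-sym (off≢on off-w on-z) ∷ []) ∷ [] ∷ []
    ... | opposite {t} y≢z y~t t~z on-t =
      off-not-on-cycle off-x (pentagon unique x~y y~t t~z (~-sym w~z) (~-sym x~w)) zero refl
      where
      unique : Unique (x ∷ y ∷ t ∷ z ∷ w ∷ [])
      unique = (off≢on off-x on-y ∷ off≢on off-x on-t ∷ off≢on off-x on-z ∷ ~⇒≢ x~w ∷ [])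
             ∷ (~⇒≢ y~t ∷ y≢z ∷ ≢-sym (off≢on off-w on-y) ∷ [])
             ∷ (~⇒≢ t~z ∷ ≢-sym (off≢on off-w on-t) ∷ [])
             ∷ (≢-sym (off≢on off-w on-z) ∷ []) ∷ [] ∷ []

    Attached : Set
    Attached = ∀ v → Off v → Σ (Fin n) λ y → On y × v ~ y

    OffNear : Fin n → Fin n → Set
    OffNear p q = ∀ v → Off v → v ~ p ⊎ v ~ q

    attached⇒leaf : Attached → ∀ {v y} → Off v → v ~ y → On y → LeafAt v y
    attached⇒leaf attached {v} {y} off-v v~y on-y = leafAt v~y only
      where
      only : OnlyNeighbour v y
      only z v~z with on-or-off z
      ... | inj₁ on-z  = sym (off-sees-one-corner off-v v~y v~z on-y on-z)
      ... | inj₂ off-z with attached z off-z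
      ...   | y′ , on-y′ , z~y′ = ⊥-elim (off-edge-detached off-v off-z v~z v~y z~y′ on-y on-y′)

    opposite-corner : ∀ {p} → On p → Σ (Fin n) λ o → On o × o ≢ p × ¬ o ~ p
    opposite-corner (inj₁ refl)               = c , inj₂ (inj₂ (inj₁ refl)) , ≢-sym a≢c , a≁c ∘ ~-sym
    opposite-corner (inj₂ (inj₁ refl))        = d , inj₂ (inj₂ (inj₂ refl)) , ≢-sym b≢d , b≁d ∘ ~-sym
    opposite-corner (inj₂ (inj₂ (inj₁ refl))) = a , inj₁ refl , a≢c , a≁c
    opposite-corner (inj₂ (inj₂ (inj₂ refl))) = b , inj₂ (inj₁ refl) , b≢d , b≁d

    AtMostOneCorner : (Fin n → Set) → Set
    AtMostOneCorner P = ∀ {y z} → On y → On z → P y → P z → y ≡ z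

    at-most-one-equal : ∀ {t} → AtMostOneCorner (_≡ t)
    at-most-one-equal _ _ y≡t z≡t = trans y≡t (sym z≡t)

    at-most-one-neighbour : ∀ {x} → Off x → AtMostOneCorner (_~ x)
    at-most-one-neighbour off-x on-y on-z y~x z~x = off-sees-one-corner off-x (~-sym y~x) (~-sym z~x) on-y on-z

    private
      tag : ∀ {P Q R : Fin n → Set} {y} → P y ⊎ Q y ⊎ R y → Fin 3
      tag (inj₁ _)        = zero
      tag (inj₂ (inj₁ _)) = suc zero
      tag (inj₂ (inj₂ _)) = suc (suc zero)

      same-tag⇒same : ∀ {P Q R} → AtMostOneCorner P → AtMostOneCorner Q → AtMostOneCorner R →
                      ∀ {y z} → On y → On z → (p : P y ⊎ Q y ⊎ R y) (q : P z ⊎ Q z ⊎ R z) →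
                      tag {P} {Q} {R} p ≡ tag {P} {Q} {R} q → y ≡ z
      same-tag⇒same one-P _ _ on-y on-z (inj₁ py)        (inj₁ pz)        _ = one-P on-y on-z py pz
      same-tag⇒same _ one-Q _ on-y on-z (inj₂ (inj₁ qy)) (inj₂ (inj₁ qz)) _ = one-Q on-y on-z qy qz
      same-tag⇒same _ _ one-R on-y on-z (inj₂ (inj₂ ry)) (inj₂ (inj₂ rz)) _ = one-R on-y on-z ry rz
      same-tag⇒same _ _ _ _ _ (inj₁ _)        (inj₂ (inj₁ _)) ()
      same-tag⇒same _ _ _ _ _ (inj₁ _)        (inj₂ (inj₂ _)) ()
      same-tag⇒same _ _ _ _ _ (inj₂ (inj₁ _)) (inj₁ _)        ()
      same-tag⇒same _ _ _ _ _ (inj₂ (inj₁ _)) (inj₂ (inj₂ _)) ()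
      same-tag⇒same _ _ _ _ _ (inj₂ (inj₂ _)) (inj₁ _)        ()
      same-tag⇒same _ _ _ _ _ (inj₂ (inj₂ _)) (inj₂ (inj₁ _)) ()

    corners-uncoverable : ∀ {P Q R} → AtMostOneCorner P → AtMostOneCorner Q → AtMostOneCorner R →
                          ¬ (∀ {y} → On y → P y ⊎ Q y ⊎ R y)
    corners-uncoverable {P} {Q} {R} one-P one-Q one-R cover
      with Fin.pigeonhole (s≤s (s≤s (s≤s (s≤s z≤n)))) (λ i → tag {P} {Q} {R} (cover (corner-on i)))
    ... | i , j , i<j , same-tag = ℕ.<⇒≢ i<j (cong toℕ (lookup-injective corners-unique i j
            (same-tag⇒same one-P one-Q one-R (corner-on i) (corner-on j) (cover (corner-on i)) (cover (corner-on j)) same-tag)))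

    inD1 : (∀ v → Off v → LeafAt v a) → Σ (Fin n) Off → InD1 G
    inD1 leaves (v , v≢a , v≢b , v≢c , v≢d) =
      a , b , c , d , (a≢b , a≢c , a≢d , b≢c , b≢d , c≢d) , (a~b , b~c , c~d , d~a , a≁c , b≁d) ,
      (λ w w≢a w≢b w≢c w≢d → leaves w (w≢a , w≢b , w≢c , w≢d)) , (v , v≢a , v≢b , v≢c , v≢d)

    inD2 : (∀ v → Off v → LeafAt v a ⊎ LeafAt v c) →
           (Σ (Fin n) λ v → Off v × LeafAt v a) → (Σ (Fin n) λ v → Off v × LeafAt v c) → InD2 G
    inD2 leaves (v , (v≢a , v≢b , v≢c , v≢d) , leaf-v) (w , (w≢a , w≢b , w≢c , w≢d) , leaf-w) =
      a , b , c , d , (a≢b , a≢c , a≢d , b≢c , b≢d , c≢d) , (a~b , b~c , c~d , d~a , a≁c , b≁d) ,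
      (λ x x≢a x≢b x≢c x≢d → leaves x (x≢a , x≢b , x≢c , x≢d)) ,
      (v , v≢a , v≢b , v≢c , v≢d , leaf-v) , (w , w≢a , w≢b , w≢c , w≢d , leaf-w)

  record SameOff (s s′ : Square) : Set where
    constructor same-off
    field
      to   : Corners.Off s ⊆ Corners.Off s′
      from : Corners.Off s′ ⊆ Corners.Off s

  rotate : Square → Square
  rotate s = record
    { a = b ; b = c ; c = d ; d = a
    ; a≢b = b≢c ; a≢c = b≢d ; a≢d = ≢-sym a≢b ; b≢c = c≢d ; b≢d = ≢-sym a≢c ; c≢d = ≢-sym a≢d
    ; a~b = b~c ; b~c = c~d ; c~d = d~a ; d~a = a~b
    ; cycles-on-square = λ C i → shift (cycles-on-square C i) }
    where
    open Square s
    shift : Quad a b c d ⊆ Quad b c d a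
    shift (inj₁ e)               = inj₂ (inj₂ (inj₂ e))
    shift (inj₂ (inj₁ e))        = inj₁ e
    shift (inj₂ (inj₂ (inj₁ e))) = inj₂ (inj₁ e)
    shift (inj₂ (inj₂ (inj₂ e))) = inj₂ (inj₂ (inj₁ e))

  rotate-same : ∀ s → SameOff s (rotate s)
  rotate-same s = same-off (λ (x≢a , x≢b , x≢c , x≢d) → x≢b , x≢c , x≢d , x≢a)
                           (λ (x≢b , x≢c , x≢d , x≢a) → x≢a , x≢b , x≢c , x≢d)

  same-trans : ∀ {s s′ s″} → SameOff s s′ → SameOff s′ s″ → SameOff s s″
  same-trans (same-off to from) (same-off to′ from′) = same-off (to′ ∘ to) (from ∘ from′)

  orient : (s : Square) → ∀ {p} → Corners.On s p → Σ Square λ s′ → Square.a s′ ≡ p × SameOff s s′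
  orient s (inj₁ refl)               = s , refl , same-off (λ o → o) (λ o → o)
  orient s (inj₂ (inj₁ refl))        = rotate s , refl , rotate-same s
  orient s (inj₂ (inj₂ (inj₁ refl))) = rotate (rotate s) , refl , same-trans (rotate-same s) (rotate-same _)
  orient s (inj₂ (inj₂ (inj₂ refl))) =
    rotate (rotate (rotate s)) , refl , same-trans (same-trans (rotate-same s) (rotate-same _)) (rotate-same _)

  D1-at : (s : Square) → ∀ {p} → Corners.On s p → (∀ v → Corners.Off s v → LeafAt v p) →
          Σ (Fin n) (Corners.Off s) → InD1 G
  D1-at s on-p leaves (w , off-w) with orient s on-p
  ... | s′ , refl , same-off to from = Corners.inD1 s′ (λ v off′ → leaves v (from off′)) (w , to off-w)

  module Recognise (s : Square) where
    open Corners s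

    a-on : On a
    a-on = inj₁ refl

    c-on : On c
    c-on = inj₂ (inj₂ (inj₁ refl))

    Touched : Fin n → Set
    Touched p = Σ (Fin n) λ v → Off v × v ~ p

    touched? : ∀ p → Dec (Touched p)
    touched? p = Fin.any? λ v → off? v ×-dec (v ~? p)

    near⇒leaf : ∀ {p q} → On p → On q → OffNear p q → ∀ {v} → Off v → v ~ p → LeafAt v p
    near⇒leaf {p} {q} on-p on-q near off-v v~p = attached⇒leaf attached off-v v~p on-p
      where
      attached : Attached
      attached v off-v = [ (λ v~p → p , on-p , v~p) , (λ v~q → q , on-q , v~q) ]′ (near v off-v)

    one-sided : ∀ {p q} → On p → On q → OffNear p q → ¬ Touched q →
                ∀ v → Off v → LeafAt v p
    one-sided on-p on-q near untouched-q v off-v with near v off-v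
    ... | inj₁ v~p = near⇒leaf on-p on-q near off-v v~p
    ... | inj₂ v~q = ⊥-elim (untouched-q (v , off-v , v~q))

    untouched : ∀ {p q} → OffNear p q → ¬ Touched p → ¬ Touched q → ¬ Σ (Fin n) Off
    untouched near untouched-p untouched-q (v , off-v) =
      [ (λ v~p → untouched-p (v , off-v , v~p)) , (λ v~q → untouched-q (v , off-v , v~q)) ]′ (near v off-v)

    off-near-sym : ∀ {p q} → OffNear p q → OffNear q p
    off-near-sym near v off-v = Sum.swap (near v off-v)

    near-opposite⇒D : OffNear a c → Σ (Fin n) Off → InD1 G ⊎ InD2 G
    near-opposite⇒D near some-off with touched? a | touched? c
    ... | yes (v , off-v , v~a) | yes (w , off-w , w~c) =
      inj₂ (inD2 leaves (v , off-v , near⇒leaf a-on c-on near off-v v~a)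
                        (w , off-w , near⇒leaf c-on a-on (off-near-sym near) off-w w~c))
      where
      leaves : ∀ x → Off x → LeafAt x a ⊎ LeafAt x c
      leaves x off-x = Sum.map (near⇒leaf a-on c-on near off-x)
                               (near⇒leaf c-on a-on (off-near-sym near) off-x) (near x off-x)
    ... | yes _       | no none-c = inj₁ (D1-at s a-on (one-sided a-on c-on near none-c) some-off)
    ... | no none-a   | yes _     = inj₁ (D1-at s c-on (one-sided c-on a-on (off-near-sym near) none-a) some-off)
    ... | no none-a   | no none-c = ⊥-elim (untouched near none-a none-c some-off)

    near-edge⇒D1 : ∀ {p q} → On p → On q → OffNear p q →
                       ¬ (IsSupport p × IsSupport q) → Σ (Fin n) Off → InD1 G
    near-edge⇒D1 {p} {q} on-p on-q near not-both some-off with touched? p | touched? q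
    ... | yes (v , off-v , v~p) | yes (w , off-w , w~q) =
      ⊥-elim (not-both (leaf⇒support (near⇒leaf on-p on-q near off-v v~p) ,
                        leaf⇒support (near⇒leaf on-q on-p (off-near-sym near) off-w w~q)))
    ... | yes _       | no none-q = D1-at s on-p (one-sided on-p on-q near none-q) some-off
    ... | no none-p   | yes _     = D1-at s on-q (one-sided on-q on-p (off-near-sym near) none-p) some-off
    ... | no none-p   | no none-q = ⊥-elim (untouched near none-p none-q some-off)

    ¬dominating-edge-corner-off : ∀ {p q} → On p → Off q → p ~ q → Dominates p q → ⊥
    ¬dominating-edge-corner-off on-p off-q p~q dominates with opposite-corner on-p
    ... | o , on-o , o≢p , o≁p with dominates o
    ...   | inj₁ o≡p               = o≢p o≡p
    ...   | inj₂ (inj₁ o≡q)        = off≢on off-q on-o (sym o≡q)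
    ...   | inj₂ (inj₂ (inj₁ o~p)) = o≁p o~p
    ...   | inj₂ (inj₂ (inj₂ o~q)) = o≢p (sym (off-sees-one-corner off-q (~-sym p~q) (~-sym o~q) on-p on-o))

    dominating-edge⇒D1 : ∀ {p q} → p ~ q → Dominates p q → ¬ (IsSupport p × IsSupport q) →
                         Σ (Fin n) Off → InD1 G
    dominating-edge⇒D1 {p} {q} p~q dominates not-both some-off with on-or-off p | on-or-off q
    ... | inj₁ on-p  | inj₁ on-q  = near-edge⇒D1 on-p on-q near not-both some-off
      where
      near : OffNear p q
      near v off-v with dominates v
      ... | inj₁ v≡p        = ⊥-elim (off≢on off-v on-p v≡p)
      ... | inj₂ (inj₁ v≡q) = ⊥-elim (off≢on off-v on-q v≡q)
      ... | inj₂ (inj₂ v~)  = v~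
    ... | inj₁ on-p  | inj₂ off-q = ⊥-elim (¬dominating-edge-corner-off on-p off-q p~q dominates)
    ... | inj₂ off-p | inj₁ on-q  = ⊥-elim (¬dominating-edge-corner-off on-q off-p (~-sym p~q) (dominates-sym dominates))
    ... | inj₂ off-p | inj₂ off-q =
      ⊥-elim (corners-uncoverable (at-most-one-neighbour off-p) (at-most-one-neighbour off-q) (λ _ _ ()) cover)
      where
      cover : ∀ {y} → On y → y ~ p ⊎ y ~ q ⊎ ⊥
      cover {y} on-y with dominates y
      ... | inj₁ y≡p               = ⊥-elim (off≢on off-p on-y (sym y≡p))
      ... | inj₂ (inj₁ y≡q)        = ⊥-elim (off≢on off-q on-y (sym y≡q))
      ... | inj₂ (inj₂ (inj₁ y~p)) = inj₁ y~p
      ... | inj₂ (inj₂ (inj₂ y~q)) = inj₂ (inj₁ y~q)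

    path-from-a-to-off : ∀ {t₂ t₃} → a ~ t₂ → t₂ ~ t₃ → Off t₃ →
                         ¬ (∀ v → v ≢ a → v ≢ t₂ → v ≢ t₃ → v ~ a ⊎ v ~ t₃)
    path-from-a-to-off {t₂} a~t₂ t₂~t₃ off-t₃ near
      with near c (≢-sym a≢c) (c≢a-neighbour a~t₂) (≢-sym (off≢on off-t₃ c-on)) | on-or-off t₂
    ... | inj₁ c~a  | _           = a≁c (~-sym c~a)
    ... | inj₂ c~t₃ | inj₁ on-t₂  = c≢a-neighbour a~t₂ (sym (off-sees-one-corner off-t₃ (~-sym t₂~t₃) (~-sym c~t₃) on-t₂ c-on))
    ... | inj₂ c~t₃ | inj₂ off-t₂ = off-edge-detached off-t₂ off-t₃ t₂~t₃ (~-sym a~t₂) (~-sym c~t₃) a-on c-on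

    path-from-a : ∀ {t₂ t₃} → a ≢ t₃ → a ~ t₂ → t₂ ~ t₃ →
                  (∀ v → v ≢ a → v ≢ t₂ → v ≢ t₃ → v ~ a ⊎ v ~ t₃) → Σ (Fin n) Off → InD1 G ⊎ InD2 G
    path-from-a {t₂} {t₃} a≢t₃ a~t₂ t₂~t₃ near some-off with on-or-off t₂ | on-or-off t₃
    ... | inj₂ off-t₂ | inj₁ on-t₃ = ⊥-elim (a≢t₃ (off-sees-one-corner off-t₂ (~-sym a~t₂) t₂~t₃ a-on on-t₃))
    ... | inj₁ on-t₂  | inj₁ (inj₁ refl)               = ⊥-elim (a≢t₃ refl)
    ... | inj₁ on-t₂  | inj₁ (inj₂ (inj₁ refl))        = ⊥-elim (triangle-free a~t₂ t₂~t₃ (~-sym a~b))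
    ... | inj₁ on-t₂  | inj₁ (inj₂ (inj₂ (inj₁ refl))) =
      near-opposite⇒D (λ v off-v@(v≢a , _ , v≢c , _) → near v v≢a (off≢on off-v on-t₂) v≢c) some-off
    ... | inj₁ on-t₂  | inj₁ (inj₂ (inj₂ (inj₂ refl))) = ⊥-elim (triangle-free a~t₂ t₂~t₃ d~a)
    ... | _           | inj₂ off-t₃ = ⊥-elim (path-from-a-to-off a~t₂ t₂~t₃ off-t₃ near)

    near-a-or-c : ∀ {e} → e ~ c → (∀ v → v ≢ a → v ≢ c → v ≢ e → v ~ a) → OffNear a c
    near-a-or-c {e} e~c near-a v (v≢a , _ , v≢c , _) with v ≟ᶠ e
    ... | yes refl = inj₂ e~c
    ... | no v≢e   = inj₁ (near-a v v≢a v≢c v≢e)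

    vertex-at-a : ∀ {t₂ t₃} → t₂ ~ t₃ → (∀ v → v ≢ a → v ≢ t₂ → v ≢ t₃ → v ~ a) →
                  Σ (Fin n) Off → InD1 G ⊎ InD2 G
    vertex-at-a {t₂} {t₃} t₂~t₃ near-a some-off with c ≟ᶠ t₂ | c ≟ᶠ t₃
    ... | yes refl | _        = near-opposite⇒D (near-a-or-c (~-sym t₂~t₃) near-a) some-off
    ... | no _     | yes refl = near-opposite⇒D (near-a-or-c t₂~t₃ λ v v≢a v≢c v≢t₂ → near-a v v≢a v≢t₂ v≢c) some-off
    ... | no c≢t₂  | no c≢t₃  = ⊥-elim (a≁c (~-sym (near-a c (≢-sym a≢c) c≢t₂ c≢t₃)))

  path⇒D : (s : Square) → ∀ {t₁ t₂ t₃} → t₁ ≢ t₃ → t₁ ~ t₂ → t₂ ~ t₃ →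
           (∀ v → v ≢ t₁ → v ≢ t₂ → v ≢ t₃ → v ~ t₁ ⊎ v ~ t₃) → Σ (Fin n) (Corners.Off s) → InD1 G ⊎ InD2 G
  path⇒D s {t₁} {t₂} {t₃} t₁≢t₃ t₁~t₂ t₂~t₃ near some-off with on-or-off t₁ | on-or-off t₃
    where open Corners s
  ... | inj₁ on-t₁ | _ with orient s on-t₁
  ...   | s′ , refl , same-off to _ = Recognise.path-from-a s′ t₁≢t₃ t₁~t₂ t₂~t₃ near (map₂ to some-off)
  path⇒D s {t₁} {t₂} {t₃} t₁≢t₃ t₁~t₂ t₂~t₃ near some-off | inj₂ _ | inj₁ on-t₃ with orient s on-t₃
  ...   | s′ , refl , same-off to _ = Recognise.path-from-a s′ (≢-sym t₁≢t₃) (~-sym t₂~t₃) (~-sym t₁~t₂)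
                                        (λ v v≢t₃ v≢t₂ v≢t₁ → Sum.swap (near v v≢t₁ v≢t₂ v≢t₃))
                                        (map₂ to some-off)
  path⇒D s {t₁} {t₂} {t₃} t₁≢t₃ t₁~t₂ t₂~t₃ near some-off | inj₂ off-t₁ | inj₂ off-t₃ =
    ⊥-elim (corners-uncoverable at-most-one-equal (at-most-one-neighbour off-t₁) (at-most-one-neighbour off-t₃) cover)
    where
    open Corners s
    cover : ∀ {y} → On y → y ≡ t₂ ⊎ y ~ t₁ ⊎ y ~ t₃
    cover {y} on-y with y ≟ᶠ t₂
    ... | yes y≡t₂ = inj₁ y≡t₂
    ... | no y≢t₂  = inj₂ (near y (≢-sym (off≢on off-t₁ on-y)) y≢t₂ (≢-sym (off≢on off-t₃ on-y)))

  edge-and-vertex⇒D : (s : Square) → ∀ {t₁ t₂ t₃} → t₂ ~ t₃ →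
                      (∀ v → v ≢ t₁ → v ≢ t₂ → v ≢ t₃ → v ~ t₁) → Σ (Fin n) (Corners.Off s) → InD1 G ⊎ InD2 G
  edge-and-vertex⇒D s {t₁} {t₂} {t₃} t₂~t₃ near-t₁ some-off with Corners.on-or-off s t₁
  ... | inj₁ on-t₁ with orient s on-t₁
  ...   | s′ , refl , same-off to _ = Recognise.vertex-at-a s′ t₂~t₃ near-t₁ (map₂ to some-off)
  edge-and-vertex⇒D s {t₁} {t₂} {t₃} t₂~t₃ near-t₁ some-off | inj₂ off-t₁ =
    ⊥-elim (corners-uncoverable at-most-one-equal at-most-one-equal (at-most-one-neighbour off-t₁) cover)
    where
    open Corners s
    cover : ∀ {y} → On y → y ≡ t₂ ⊎ y ≡ t₃ ⊎ y ~ t₁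
    cover {y} on-y with y ≟ᶠ t₂ | y ≟ᶠ t₃
    ... | yes y≡t₂ | _        = inj₁ y≡t₂
    ... | no _     | yes y≡t₃ = inj₂ (inj₁ y≡t₃)
    ... | no y≢t₂  | no y≢t₃  = inj₂ (inj₂ (near-t₁ y (≢-sym (off≢on off-t₁ on-y)) y≢t₂ y≢t₃))

  shape⇒D : (s : Square) → Shape → Σ (Fin n) (Corners.Off s) → InD1 G ⊎ InD2 G
  shape⇒D s (dominating-edge p~q dominates not-both) = inj₁ ∘ Recognise.dominating-edge⇒D1 s p~q dominates not-both
  shape⇒D s (path t₁≢t₃ t₁~t₂ t₂~t₃ near)         = path⇒D s t₁≢t₃ t₁~t₂ t₂~t₃ near
  shape⇒D s (edge-and-vertex t₂~t₃ near-t₁)          = edge-and-vertex⇒D s t₂~t₃ near-t₁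

  square-of-4-cycle : (C : Cycle G) → cycLength G C ≡ 4 →
                      (∀ (C′ : Cycle G) x y → CycEdge G C′ x y → CycEdge G C x y) → Square
  square-of-4-cycle record { vert = v ; distinct = distinct ; around = around } refl edges-of = record
    { a = v zero ; b = v (suc zero) ; c = v (suc (suc zero)) ; d = v (suc (suc (suc zero)))
    ; a≢b = apart λ () ; a≢c = apart λ () ; a≢d = apart λ () ; b≢c = apart λ () ; b≢d = apart λ () ; c≢d = apart λ ()
    ; a~b = around zero ; b~c = around (suc zero) ; c~d = around (suc (suc zero)) ; d~a = around (suc (suc (suc zero)))
    ; cycles-on-square = on-cycle }
    where
    apart : ∀ {i j} → i ≢ j → v i ≢ v j
    apart i≢j = i≢j ∘ distinct
    On₄ : Fin n → Set
    On₄ = Quad (v zero) (v (suc zero)) (v (suc (suc zero))) (v (suc (suc (suc zero))))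
    vertex-on : ∀ i → On₄ (v i)
    vertex-on zero                   = inj₁ refl
    vertex-on (suc zero)             = inj₂ (inj₁ refl)
    vertex-on (suc (suc zero))       = inj₂ (inj₂ (inj₁ refl))
    vertex-on (suc (suc (suc zero))) = inj₂ (inj₂ (inj₂ refl))
    on-cycle : ∀ (C′ : Cycle G) i → On₄ (Cycle.vert C′ i)
    on-cycle C′ i with edges-of C′ (Cycle.vert C′ i) (Cycle.vert C′ (nextF G i)) (i , inj₁ (refl , refl))
    ... | j , inj₁ (vj≡x , _) = subst On₄ vj≡x (vertex-on j)
    ... | j , inj₂ (_ , vj′≡x) = subst On₄ vj′≡x (vertex-on (nextF G j))

  module SquareOnly (s : Square) (all-on : ∀ x → Corners.On s x) where
    open Corners s
    open PairedDomination G

    corner : Fin 4 → Fin n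
    corner = lookup corners

    index : Fin n → Fin 4
    index x = corner-index (all-on x)

    index-injective : ∀ {w v} → index w ≡ index v → w ≡ v
    index-injective {w} {v} e =
      trans (sym (lookup-corner-index (all-on w))) (trans (cong corner e) (lookup-corner-index (all-on v)))

    index-corner : ∀ i → index (corner i) ≡ i
    index-corner i = lookup-injective corners-unique _ _ (lookup-corner-index (all-on (corner i)))

    next : Fin 4 → Fin 4
    next zero                   = suc zero
    next (suc zero)             = suc (suc zero)
    next (suc (suc zero))       = suc (suc (suc zero))
    next (suc (suc (suc zero))) = zero

    next≢ : ∀ i → next i ≢ i
    next≢ zero                   ()
    next≢ (suc zero)             ()
    next≢ (suc (suc zero))       ()
    next≢ (suc (suc (suc zero))) ()

    corner~next : ∀ i → corner i ~ corner (next i)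
    corner~next zero                   = a~b
    corner~next (suc zero)             = b~c
    corner~next (suc (suc zero))       = c~d
    corner~next (suc (suc (suc zero))) = d~a

    corner-dominates : ∀ i → Dominates (corner i) (corner (next i))
    corner-dominates zero w with all-on w
    ... | inj₁ refl               = inj₁ refl
    ... | inj₂ (inj₁ refl)        = inj₂ (inj₁ refl)
    ... | inj₂ (inj₂ (inj₁ refl)) = inj₂ (inj₂ (inj₂ (~-sym b~c)))
    ... | inj₂ (inj₂ (inj₂ refl)) = inj₂ (inj₂ (inj₁ d~a))
    corner-dominates (suc zero) w with all-on w
    ... | inj₁ refl               = inj₂ (inj₂ (inj₁ a~b))
    ... | inj₂ (inj₁ refl)        = inj₁ refl
    ... | inj₂ (inj₂ (inj₁ refl)) = inj₂ (inj₁ refl)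
    ... | inj₂ (inj₂ (inj₂ refl)) = inj₂ (inj₂ (inj₂ (~-sym c~d)))
    corner-dominates (suc (suc zero)) w with all-on w
    ... | inj₁ refl               = inj₂ (inj₂ (inj₂ (~-sym d~a)))
    ... | inj₂ (inj₁ refl)        = inj₂ (inj₂ (inj₁ b~c))
    ... | inj₂ (inj₂ (inj₁ refl)) = inj₁ refl
    ... | inj₂ (inj₂ (inj₂ refl)) = inj₂ (inj₁ refl)
    corner-dominates (suc (suc (suc zero))) w with all-on w
    ... | inj₁ refl               = inj₂ (inj₁ refl)
    ... | inj₂ (inj₁ refl)        = inj₂ (inj₂ (inj₂ (~-sym a~b)))
    ... | inj₂ (inj₂ (inj₁ refl)) = inj₂ (inj₂ (inj₁ c~d))
    ... | inj₂ (inj₂ (inj₂ refl)) = inj₁ refl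

    class-is-corner : ∀ {i v} → index v ≡ i → v ≡ corner i
    class-is-corner e = index-injective (trans e (sym (index-corner _)))

    partition : PcPartition G 4
    partition = index , (λ i → corner i , index-corner i) , not-pd , partner
      where
      not-pd : ∀ i → ¬ PD (λ v → index v ≡ i)
      not-pd i (_ , pm) = noPM-singleton class-is-corner (index-corner i) pm
      partner : ∀ i → Σ (Fin 4) λ j → j ≢ i × PD (λ v → index v ≡ i ⊎ index v ≡ j)
      partner i = next i , next≢ i ,
                  pd-resp (Sum.map (λ { refl → index-corner i }) (λ { refl → index-corner (next i) }))
                          (Sum.map class-is-corner class-is-corner)
                          (dominating-edge⇒pd (corner~next i) (corner-dominates i))

module PendantSquares {n : ℕ} (G : Graph n) where
  open Basics G
  open PairedDomination G

  -- D₁ ∪ D₂: the vertices off the 4-cycle are leaves at a or at c, at least one at a.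
  record PendantSquare : Set where
    field
      a b c d   : Fin n
      a≢b       : a ≢ b
      a≢c       : a ≢ c
      a≢d       : a ≢ d
      b≢c       : b ≢ c
      b≢d       : b ≢ d
      c≢d       : c ≢ d
      a~b       : a ~ b
      b~c       : b ~ c
      c~d       : c ~ d
      d~a       : d ~ a
      a≁c       : ¬ a ~ c
      pendants  : ∀ v → v ≢ a → v ≢ b → v ≢ c → v ≢ d → LeafAt v a ⊎ LeafAt v c
      leaf      : Fin n
      leaf≢a    : leaf ≢ a
      leaf≢b    : leaf ≢ b
      leaf≢c    : leaf ≢ c
      leaf≢d    : leaf ≢ d
      leaf-at-a : LeafAt leaf a

  D⇒pendantSquare : InD1 G ⊎ InD2 G → PendantSquare
  D⇒pendantSquare (inj₁ (a , b , c , d , (a≢b , a≢c , a≢d , b≢c , b≢d , c≢d) , (a~b , b~c , c~d , d~a , a≁c , _) ,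
                       leaves , (l , l≢a , l≢b , l≢c , l≢d))) =
    record { a = a ; b = b ; c = c ; d = d ; a≢b = a≢b ; a≢c = a≢c ; a≢d = a≢d ; b≢c = b≢c ; b≢d = b≢d ; c≢d = c≢d
           ; a~b = a~b ; b~c = b~c ; c~d = c~d ; d~a = d~a ; a≁c = a≁c
           ; pendants = λ v v≢a v≢b v≢c v≢d → inj₁ (leaves v v≢a v≢b v≢c v≢d)
           ; leaf = l ; leaf≢a = l≢a ; leaf≢b = l≢b ; leaf≢c = l≢c ; leaf≢d = l≢d ; leaf-at-a = leaves l l≢a l≢b l≢c l≢d }
  D⇒pendantSquare (inj₂ (a , b , c , d , (a≢b , a≢c , a≢d , b≢c , b≢d , c≢d) , (a~b , b~c , c~d , d~a , a≁c , _) ,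
                       leaves , (l , l≢a , l≢b , l≢c , l≢d , leaf-l) , _)) =
    record { a = a ; b = b ; c = c ; d = d ; a≢b = a≢b ; a≢c = a≢c ; a≢d = a≢d ; b≢c = b≢c ; b≢d = b≢d ; c≢d = c≢d
           ; a~b = a~b ; b~c = b~c ; c~d = c~d ; d~a = d~a ; a≁c = a≁c ; pendants = leaves
           ; leaf = l ; leaf≢a = l≢a ; leaf≢b = l≢b ; leaf≢c = l≢c ; leaf≢d = l≢d ; leaf-at-a = leaf-l }

  module OfPendantSquare (D : PendantSquare) where
    open PendantSquare D

    5≤n : 5 ≤ n
    5≤n = unique⇒≤ {vs = a ∷ b ∷ c ∷ d ∷ leaf ∷ []}
      ((a≢b ∷ a≢c ∷ a≢d ∷ ≢-sym leaf≢a ∷ []) ∷ (b≢c ∷ b≢d ∷ ≢-sym leaf≢b ∷ []) ∷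
       (c≢d ∷ ≢-sym leaf≢c ∷ []) ∷ (≢-sym leaf≢d ∷ []) ∷ [] ∷ [])

    pc-bound : ∀ {k} → PcPartition G k → 2 + k ≤ n
    pc-bound P = PcClasses.leaf-and-nonneighbour⇒2+k≤n G P (λ w → Equivalence.to (leaf-at-a w)) (≢-sym a≢c) a≁c

    dominating : ∀ {S : Fin n → Set} → S a → S c → Dominating G S
    dominating sa sc w with w ≟ᶠ a | w ≟ᶠ b | w ≟ᶠ c | w ≟ᶠ d
    ... | yes refl | _        | _        | _        = inj₁ sa
    ... | no _     | yes refl | _        | _        = inj₂ (a , sa , ~-sym a~b)
    ... | no _     | no _     | yes refl | _        = inj₁ sc
    ... | no _     | no _     | no _     | yes refl = inj₂ (a , sa , d~a)
    ... | no w≢a   | no w≢b   | no w≢c   | no w≢d with pendants w w≢a w≢b w≢c w≢d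
    ...   | inj₁ leaf-at = inj₂ (a , sa , Equivalence.from (leaf-at a) refl)
    ...   | inj₂ leaf-at = inj₂ (c , sc , Equivalence.from (leaf-at c) refl)

    matching : ∀ {v} → ¬ Triple a b c v → HasPM (Quad a b c v)
    matching {v} v∉ with v ≟ᶠ d
    ... | yes refl = pm-quad (λ q → q) (inj₁ refl) (inj₂ (inj₁ refl)) (inj₂ (inj₂ (inj₁ refl))) (inj₂ (inj₂ (inj₂ refl)))
                       a≢c a≢d b≢c b≢d a~b c~d
    ... | no v≢d = pendant-matching (pendants v v≢a v≢b v≢c v≢d)
      where
      v≢a : v ≢ a
      v≢a v≡a = v∉ (inj₁ v≡a)
      v≢b : v ≢ b
      v≢b v≡b = v∉ (inj₂ (inj₁ v≡b))
      v≢c : v ≢ c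
      v≢c v≡c = v∉ (inj₂ (inj₂ v≡c))
      a-first : Quad a b c v ⊆ Quad v a b c
      a-first (inj₁ e)               = inj₂ (inj₁ e)
      a-first (inj₂ (inj₁ e))        = inj₂ (inj₂ (inj₁ e))
      a-first (inj₂ (inj₂ (inj₁ e))) = inj₂ (inj₂ (inj₂ e))
      a-first (inj₂ (inj₂ (inj₂ e))) = inj₁ e
      c-first : Quad a b c v ⊆ Quad v c a b
      c-first (inj₁ e)               = inj₂ (inj₂ (inj₁ e))
      c-first (inj₂ (inj₁ e))        = inj₂ (inj₂ (inj₂ e))
      c-first (inj₂ (inj₂ (inj₁ e))) = inj₂ (inj₁ e)
      c-first (inj₂ (inj₂ (inj₂ e))) = inj₁ e
      pendant-matching : LeafAt v a ⊎ LeafAt v c → HasPM (Quad a b c v)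
      pendant-matching (inj₁ leaf-at) =
        pm-quad a-first (inj₂ (inj₂ (inj₂ refl))) (inj₁ refl) (inj₂ (inj₁ refl)) (inj₂ (inj₂ (inj₁ refl)))
                v≢b v≢c a≢b a≢c (Equivalence.from (leaf-at a) refl) b~c
      pendant-matching (inj₂ leaf-at) =
        pm-quad c-first (inj₂ (inj₂ (inj₂ refl))) (inj₂ (inj₂ (inj₁ refl))) (inj₁ refl) (inj₂ (inj₁ refl))
                v≢a v≢b (≢-sym a≢c) (≢-sym b≢c) (Equivalence.from (leaf-at c) refl) a~b

    pd-with : ∀ {v} → ¬ Triple a b c v → PD (Quad a b c v)
    pd-with v∉ = dominating (inj₁ refl) (inj₂ (inj₂ (inj₁ refl))) , matching v∉

module PendantSquarePartition {m : ℕ} (G : Graph (2 + m)) (D : PendantSquares.PendantSquare G) where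
  open Basics G
  open PairedDomination G
  open PendantSquares G
  open PendantSquare D
  open OfPendantSquare D
  open Collapse a≢b a≢c b≢c

  Class : Fin m → Fin (2 + m) → Set
  Class i v = collapse v ≡ i

  triple? : ∀ v → Dec (Triple a b c v)
  triple? v = (v ≟ᶠ a) ⊎-dec (v ≟ᶠ b) ⊎-dec (v ≟ᶠ c)

  collapse-triple : ∀ {v} → Triple a b c v → collapse v ≡ collapse a
  collapse-triple (inj₁ refl)        = refl
  collapse-triple (inj₂ (inj₁ refl)) = collapse-b
  collapse-triple (inj₂ (inj₂ refl)) = collapse-c

  d∉ : ¬ Triple a b c d
  d∉ = ∉-triple (≢-sym a≢d) (≢-sym b≢d) (≢-sym c≢d)

  union-pd : ∀ {v} → ¬ Triple a b c v → PD (Class (collapse a) ∪ Class (collapse v))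
  union-pd {v} v∉ = pd-resp to from (pd-with v∉)
    where
    to : Quad a b c v ⊆ Class (collapse a) ∪ Class (collapse v)
    to (inj₂ (inj₂ (inj₂ refl))) = inj₂ refl
    to (inj₁ e)                  = inj₁ (collapse-triple (inj₁ e))
    to (inj₂ (inj₁ e))           = inj₁ (collapse-triple (inj₂ (inj₁ e)))
    to (inj₂ (inj₂ (inj₁ e)))    = inj₁ (collapse-triple (inj₂ (inj₂ e)))
    from : Class (collapse a) ∪ Class (collapse v) ⊆ Quad a b c v
    from (inj₁ e) with collapse-fibre-a e
    ... | inj₁ w≡a        = inj₁ w≡a
    ... | inj₂ (inj₁ w≡b) = inj₂ (inj₁ w≡b)
    ... | inj₂ (inj₂ w≡c) = inj₂ (inj₂ (inj₁ w≡c))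
    from (inj₂ e) = inj₂ (inj₂ (inj₂ (collapse-fibre-other v∉ e)))

  partition : PcPartition G m
  partition = collapse , collapse-surjective , not-pd , partner
    where
    not-pd : ∀ i → ¬ PD (Class i)
    not-pd i (_ , pm) with collapse-surjective i
    ... | v , refl with triple? v
    ...   | yes v∈ = noPM-triple (collapse-fibre-a ∘ (λ e → trans e (collapse-triple v∈)))
                       (sym (collapse-triple v∈)) (trans collapse-b (sym (collapse-triple v∈)))
                       (trans collapse-c (sym (collapse-triple v∈))) a≢b a≢c b≢c pm
    ...   | no v∉  = noPM-singleton (collapse-fibre-other v∉) refl pm
    partner : ∀ i → Σ (Fin m) λ j → j ≢ i × PD (Class i ∪ Class j)
    partner i with collapse-surjective i
    ... | v , refl with triple? v
    ...   | yes v∈ = collapse d , (λ e → d∉ (collapse-fibre-a (trans e (collapse-triple v∈)))) ,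
                     subst (λ j → PD (Class j ∪ Class (collapse d))) (sym (collapse-triple v∈)) (union-pd d∉)
    ...   | no v∉  = collapse a , (λ e → v∉ (collapse-fibre-a (sym e))) ,
                     pd-resp Sum.swap Sum.swap (union-pd v∉)

module PCValue {n : ℕ} (G : Graph n) where

  attained : ∀ {p} → 1 ≤ p → PCis G p → PcPartition G p
  attained _ (inj₁ (P , _)) = P
  attained () (inj₂ (refl , _))

  bounded : ∀ {p k} → PCis G p → PcPartition G k → k ≤ p
  bounded (inj₁ (_ , maximal)) P = maximal _ P
  bounded (inj₂ (_ , none))    P = ⊥-elim (none _ P)

module Characterisation {m : ℕ} (G : Graph (2 + m)) (triangle-free : Basics.TriangleFree G)
                        (s : Squares.Square G triangle-free) where
  open Squares G triangle-free
  open Corners s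
  open PCValue G

  pc⇒D : Σ (Fin (2 + m)) Off → PCis G m → InD1 G ⊎ InD2 G
  pc⇒D some-off pc = shape⇒D s (Tight.shape G triangle-free P 3≤m (ℕ.n≮n (2 + m))) some-off
    where
    3≤m : 3 ≤ m
    3≤m = ℕ.≤-pred (ℕ.≤-pred (off⇒5≤n some-off))
    P : PcPartition G m
    P = attained (ℕ.≤-trans (s≤s z≤n) 3≤m) pc

  D⇒pc : InD1 G ⊎ InD2 G → PCis G m
  D⇒pc D = inj₁ (PendantSquarePartition.partition G D′ ,
                 λ k P → ℕ.≤-pred (ℕ.≤-pred (PendantSquares.OfPendantSquare.pc-bound G D′ P)))
    where
    D′ : PendantSquares.PendantSquare G
    D′ = PendantSquares.D⇒pendantSquare G D

  module _ (all-on : ∀ x → On x) where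

    m≤2 : m ≤ 2
    m≤2 = ℕ.≤-pred (ℕ.≤-pred (all-on⇒n≤4 all-on))

    square-only⇒¬pc : ¬ PCis G m
    square-only⇒¬pc pc with ℕ.≤-trans (bounded pc (SquareOnly.partition s all-on)) m≤2
    ... | s≤s (s≤s ())

    square-only⇒¬D : ¬ (InD1 G ⊎ InD2 G)
    square-only⇒¬D D = ℕ.n≮n 4 (ℕ.≤-trans (PendantSquares.OfPendantSquare.5≤n G (PendantSquares.D⇒pendantSquare G D))
                                          (all-on⇒n≤4 all-on))

  pc⇔D : PCis G m ⇔ (InD1 G ⊎ InD2 G)
  pc⇔D with Fin.any? off?
  ... | yes some-off = mk⇔ (pc⇒D some-off) D⇒pc
  ... | no no-off    = mk⇔ (⊥-elim ∘ square-only⇒¬pc all-on) (⊥-elim ∘ square-only⇒¬D all-on)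
    where
    all-on : ∀ x → On x
    all-on x with on-or-off x
    ... | inj₁ on-x  = on-x
    ... | inj₂ off-x = ⊥-elim (no-off (x , off-x))

characterisation : ∀ {n} (G : Graph n) (triangle-free : Basics.TriangleFree G) →
                   Squares.Square G triangle-free → PCis G (n ∸ 2) ⇔ (InD1 G ⊎ InD2 G)
characterisation {zero}        G triangle-free s with Squares.Corners.4≤n G triangle-free s
... | ()
characterisation {suc zero}    G triangle-free s with Squares.Corners.4≤n G triangle-free s
... | s≤s ()
characterisation {suc (suc m)} G triangle-free s = Characterisation.pc⇔D G triangle-free s

unicyclic⇒square : ∀ {n} (G : Graph n) (girth : Girth G 4) → Unicyclic G →
                   Squares.Square G (Basics.girth4⇒triangle-free G girth)
unicyclic⇒square G girth@((C , length) , _) (_ , _ , same-edges) =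
  Squares.square-of-4-cycle G (Basics.girth4⇒triangle-free G girth) C length λ C′ x y on-C′ →
    Equivalence.to (same-edges C x y) (Equivalence.from (same-edges C′ x y) on-C′)

mainTheorem18 : ∀ (n : ℕ) (G : Graph n) → Unicyclic G → Girth G 4 →
    PCis G (n ∸ 2) ⇔ (InD1 G ⊎ InD2 G)
mainTheorem18 n G unicyclic girth =
  characterisation G (Basics.girth4⇒triangle-free G girth) (unicyclic⇒square G girth unicyclic)
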